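{- Let $\mathcal O$ be a $\mathcal{RIQ}$-ontology, $C$ a concept and $x$ a label. If the sequent $\emptyset\vdash x:C$ is valid relative to $\mathcal O$, then $\mathsf S(\mathcal O)\Vdash\emptyset\vdash x:\mathrm{GCI}(\mathcal O),x:C$.
   Context: Language. Fix countable pairwise disjoint sets $\mathsf{N_C}$ (concept names) and $\mathsf{N_R}$ (role names). A role is $r$ or $r^-$ with $r\in\mathsf{N_R}$; $\mathrm{Inv}(r)=r^-$, $\mathrm{Inv}(r^-)=r$; $\mathbf{R}$ is the set of roles. An RIA is $r_1\circ\cdots\circ r_n\sqsubseteq s$ with $r_i,s\in\mathbf R$; an RBox is a finite set of RIAs. It is regular iff for some strict partial order $\prec$ on $\mathsf{N_R}$ every RIA $w\sqsubseteq r$ in it has $r\in\mathsf{N_R}$ and $w$ equal to $r\circ r$, $r^-$, $s_1\circ\cdots\circ s_n$, $r\circ s_1\circ\cdots\circ s_n$, or $s_1\circ\cdots\circ s_n\circ r$ with all $s_i\prec r$. A role name $r$ is simple w.r.t. RBox $\mathcal R$ iff no RIA $w\sqsubseteq r$ is in $\mathcal R$, or for each $s\sqsubseteq r\in\mathcal R$, $s$ is a simple role name or the inverse of one; $r^-$ is simple iff $r$ is. Concepts: $C::=A\mid\neg A\mid C\sqcup C\mid C\sqcap C\mid\exists r.C\mid\forall r.C\mid{\leqslant}n\,s.C\mid{\geqslant}n\,s.C$ ($A\in\mathsf{N_C}$, $r\in\mathbf R$, $s$ simple, $n\in\mathbb N$). $\top:=A_0\sqcup\neg A_0$, $\bot:=A_0\sqcap\neg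 A_0$ for fixed $A_0$; literals are $A,\neg A$. Negation $\dot\neg$: $\dot\neg A=\neg A$, $\dot\neg\neg A=A$, De Morgan on $\sqcup,\sqcap$, $\exists/\forall$ dual, $\dot\neg({\leqslant}n\,s.C)={\geqslant}(n{+}1)\,s.C$, $\dot\neg({\geqslant}0\,s.C)=\bot$, $\dot\neg({\geqslant}n\,s.C)={\leqslant}(n{ - }1)\,s.C$ ($n>0$). A TBox is a finite set of GCIs, each $\top\sqsubseteq C$; a $\mathcal{RIQ}$-ontology is $\mathcal R\cup\mathcal T$, $\mathcal R$ regular RBox, $\mathcal T$ TBox. Semantics standard ($(r^-)^{\mathcal I}$ converse of $r^{\mathcal I}$, counting quantifiers count $s$-successors in $C$); $\mathcal I\models\mathcal O$ iff all RIAs and GCIs hold. $\mathbf R$-system: for each RIA $r_1\circ\cdots\circ r_n\sqsubseteq s\in\mathcal O$ there are productions $s\to r_1\cdots r_n$ and $\mathrm{Inv}(s)\to\mathrm{Inv}(r_n)\cdots\mathrm{Inv}(r_1)$; a rewrite replaces one occurrence of a role $t$ in a string by $T$ for a production $t\to T$; $L_{\mathcal O}(r)$ is the set of strings reachable from the string $r$ by zero or more rewrites. Sequents: $\mathrm{Lab}$ is a countably infinite set of labels. Structural atoms: $r(x,y)$, $x\doteq y$, $x\not\doteq y$; labeled concepts $x:C$. $\Gamma$ forms a tree iff the directed graph on $\mathrm{Lab}(\Gamma)$ with an edge $(x,y)$ per $r(x,y)\in\Gamma$ is a directed tree. A sequent $\Gamma\vdash\Delta$: $\Gamma$ a set of structural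 atoms forming a tree, $\Delta$ a multiset of labeled concepts, $\mathrm{Lab}(\Delta)\subseteq\mathrm{Lab}(\Gamma)$ if $\Gamma\ne\emptyset$, exactly one label in $\Delta$ if $\Gamma=\emptyset$. If the TBox is $\{\top\sqsubseteq C_1,\dots,\top\sqsubseteq C_n\}$, $y:\mathrm{GCI}(\mathcal O)$ denotes $y:\dot\neg C_1,\dots,y:\dot\neg C_n$. $\neq(y_0,\dots,y_n)=\{y_i\not\doteq y_j\mid i<j\}$. $x=^*_\Gamma y$ iff $x,y$ are connected by a (possibly trivial) chain of labels of $\Gamma$ with consecutive ones related by an equality atom of $\Gamma$ in either orientation; $[x]_\Gamma$ its class. Propagation graph of $\Gamma$: vertices $[x]_\Gamma$, edges $([x]_\Gamma,r,[y]_\Gamma)$ and $([y]_\Gamma,\mathrm{Inv}(r),[x]_\Gamma)$ whenever $r(z,w)\in\Gamma$, $z\in[x]_\Gamma$, $w\in[y]_\Gamma$. $[x]_\Gamma\xrightarrow{\varepsilon}[y]_\Gamma$ iff equal; $[x]_\Gamma\xrightarrow{rS}[y]_\Gamma$ iff some edge $([x]_\Gamma,r,[z]_\Gamma)$ with $[z]_\Gamma\xrightarrow{S}[y]_\Gamma$; $[x]_\Gamma\xrightarrow{L}[y]_\Gamma$ iff this holds for some $S\in L$. Calculus $\mathsf S(\mathcal O)$ (premises / conclusion; fresh = not occurring in the conclusion): (id) none / $\Gamma\vdash x:A,x:\neg A,\Delta$. (id$_\doteq$) none / $\Gamma,x\not\doteq y\vdash\Delta$ if $x=^*y$ in the antecedent.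 ($s_\doteq$) $\Gamma\vdash x:L,y:L,\Delta$ / $\Gamma\vdash x:L,\Delta$ ($L$ literal, $x=^*_\Gamma y$). ($\sqcup$) $\Gamma\vdash x:C,x:D,\Delta$ / $\Gamma\vdash x:C\sqcup D,\Delta$. ($\sqcap$) $\Gamma\vdash x:C,\Delta$ and $\Gamma\vdash x:D,\Delta$ / $\Gamma\vdash x:C\sqcap D,\Delta$. ($\exists r$) $\Gamma\vdash x:\exists r.C,y:C,\Delta$ / $\Gamma\vdash x:\exists r.C,\Delta$ if $[x]_\Gamma\xrightarrow{L}[y]_\Gamma$, $L=L_{\mathcal O}(r)$. ($\forall r$) $\Gamma,r(x,y)\vdash y:C,y:\mathrm{GCI}(\mathcal O),\Delta$ / $\Gamma\vdash x:\forall r.C,\Delta$, $y$ fresh. (${\leqslant}n\,r$) $\Gamma,\neq(y_0,\dots,y_n),r(x,y_0),\dots,r(x,y_n)\vdash y_0:\dot\neg C,y_0:\mathrm{GCI}(\mathcal O),\dots,y_n:\dot\neg C,y_n:\mathrm{GCI}(\mathcal O),\Delta$ / $\Gamma\vdash x:{\leqslant}n\,r.C,\Delta$, $y_i$ fresh. (${\geqslant}n\,r$) $\Gamma\vdash y_i:C,x:{\geqslant}n\,r.C,\Delta$ ($1\le i\le n$) and $\Gamma,y_i\doteq y_j\vdash x:{\geqslant}n\,r.C,\Delta$ ($1\le i<j\le n$) / $\Gamma\vdash x:{\geqslant}n\,r.C,\Delta$ if $[x]_\Gamma\xrightarrow{L}[y_i]_\Gamma$, $L=L_{\mathcal O}(r)$,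 for all $i$. A proof is a finite tree of rule instances; $\mathsf S(\mathcal O)\Vdash S$ means $S$ has a proof. Validity: $\emptyset\vdash x:C$ is valid relative to $\mathcal O$ iff for every interpretation $\mathcal I\models\mathcal O$ and every $\lambda(x)\in\Delta^{\mathcal I}$ we have $\lambda(x)\in C^{\mathcal I}$ (in general, a sequent $\Gamma\vdash\Delta$ is valid relative to $\mathcal O$ iff for every model $\mathcal I$ of $\mathcal O$ and assignment $\lambda$ of domain elements to labels satisfying all atoms of $\Gamma$, some $x:C\in\Delta$ has $\lambda(x)\in C^{\mathcal I}$). -}

module Defs where

open import Level using (0ℓ)
open import Data.Nat using (ℕ; zero; suc; _≤_)
open import Data.Fin using (Fin)
open import Data.Product using (Σ; _×_; _,_; proj₁)
open import Data.Sum using (_⊎_)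
open import Data.Empty using (⊥)
open import Data.List using (List; []; _∷_; _++_; map; reverse; length; concatMap)
open import Data.List.Membership.Propositional using (_∈_; _∉_)
open import Data.List.Relation.Unary.All using (All)
open import Data.List.Relation.Unary.Any using (Any)
open import Data.List.Relation.Unary.Unique.Propositional using (Unique)
open import Data.List.Relation.Binary.Permutation.Propositional using (_↭_)
open import Relation.Nullary using (¬_)
open import Relation.Binary using (Rel; IsStrictPartialOrder)
open import Relation.Binary.PropositionalEquality using (_≡_; _≢_)
open import Relation.Binary.Construct.Closure.Symmetric using (SymClosure)
open import Relation.Binary.Construct.Closure.ReflexiveTransitive using (Star)
open import Function.Definitions using (Injective)

ConceptName RoleName Label : Set
ConceptName = ℕ
RoleName = ℕ
Label = ℕ

data Role : Set where
  rn  : RoleName → Role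
  inv : RoleName → Role

Inv : Role → Role
Inv (rn r)  = inv r
Inv (inv r) = rn r

baseName : Role → RoleName
baseName (rn r)  = r
baseName (inv r) = r

record RIA : Set where
  constructor _⊑_
  field
    lhs : List Role
    rhs : Role
open RIA public

RBox : Set
RBox = List RIA

data Concept : Set where
  atom   : ConceptName → Concept
  neg    : ConceptName → Concept
  _⊔_    : Concept → Concept → Concept
  _⊓_    : Concept → Concept → Concept
  ex     : Role → Concept → Concept
  all    : Role → Concept → Concept
  atMost : ℕ → Role → Concept → Concept
  atLeast : ℕ → Role → Concept → Concept

A₀ : ConceptName
A₀ = 0

⊤c ⊥c : Concept
⊤c = atom A₀ ⊔ neg A₀
⊥c = atom A₀ ⊓ neg A₀

data Literal : Concept → Set where
  lit+ : ∀ A → Literal (atom A)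
  lit- : ∀ A → Literal (neg A)

¬̇ : Concept → Concept
¬̇ (atom A) = neg A
¬̇ (neg A) = atom A
¬̇ (C ⊔ D) = ¬̇ C ⊓ ¬̇ D
¬̇ (C ⊓ D) = ¬̇ C ⊔ ¬̇ D
¬̇ (ex r C) = all r (¬̇ C)
¬̇ (all r C) = ex r (¬̇ C)
¬̇ (atMost n s C) = atLeast (suc n) s C
¬̇ (atLeast zero s C) = ⊥c
¬̇ (atLeast (suc n) s C) = atMost n s C

-- TBox: the list [C₁,…,Cₙ] stands for {⊤ ⊑ C₁, …, ⊤ ⊑ Cₙ}
TBox : Set
TBox = List Concept

record Ontology : Set where
  constructor ⟨_,_⟩
  field
    rbox : RBox
    tbox : TBox
open Ontology public

data RegularForm (_≺_ : Rel RoleName 0ℓ) : RIA → Set where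
  rr    : ∀ r → RegularForm _≺_ ((rn r ∷ rn r ∷ []) ⊑ rn r)
  rinv  : ∀ r → RegularForm _≺_ ((inv r ∷ []) ⊑ rn r)
  ss    : ∀ r s ss → All (λ t → baseName t ≺ r) (s ∷ ss)
        → RegularForm _≺_ ((s ∷ ss) ⊑ rn r)
  rss   : ∀ r s ss → All (λ t → baseName t ≺ r) (s ∷ ss)
        → RegularForm _≺_ ((rn r ∷ s ∷ ss) ⊑ rn r)
  ssr   : ∀ r s ss → All (λ t → baseName t ≺ r) (s ∷ ss)
        → RegularForm _≺_ (((s ∷ ss) ++ (rn r ∷ [])) ⊑ rn r)

Regular : RBox → Set₁
Regular R = Σ (Rel RoleName 0ℓ) λ _≺_ →
  IsStrictPartialOrder _≡_ _≺_ × All (RegularForm _≺_) R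

data NonSimple (R : RBox) : Role → Set where
  composite : ∀ {r w} → (w ⊑ rn r) ∈ R → (∀ s → w ≢ (s ∷ [])) → NonSimple R (rn r)
  viaRole   : ∀ {r s} → ((s ∷ []) ⊑ rn r) ∈ R → NonSimple R s → NonSimple R (rn r)
  viaInv    : ∀ {r} → NonSimple R (rn r) → NonSimple R (inv r)

Simple : RBox → Role → Set
Simple R s = ¬ NonSimple R s

data IsConcept (R : RBox) : Concept → Set where
  atom    : ∀ A → IsConcept R (atom A)
  neg     : ∀ A → IsConcept R (neg A)
  _⊔_     : ∀ {C D} → IsConcept R C → IsConcept R D → IsConcept R (C ⊔ D)
  _⊓_     : ∀ {C D} → IsConcept R C → IsConcept R D → IsConcept R (C ⊓ D)
  ex      : ∀ r {C} → IsConcept R C → IsConcept R (ex r C)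
  all     : ∀ r {C} → IsConcept R C → IsConcept R (all r C)
  atMost  : ∀ n s {C} → Simple R s → IsConcept R C → IsConcept R (atMost n s C)
  atLeast : ∀ n s {C} → Simple R s → IsConcept R C → IsConcept R (atLeast n s C)

IsRIQ : Ontology → Set₁
IsRIQ O = Regular (rbox O) × All (IsConcept (rbox O)) (tbox O)

record Interpretation : Set₁ where
  field
    Dom   : Set
    conc  : ConceptName → Dom → Set
    role  : RoleName → Dom → Dom → Set
open Interpretation public

module _ (I : Interpretation) where

  ⟦_⟧R : Role → Dom I → Dom I → Set
  ⟦ rn r ⟧R d e  = role I r d e
  ⟦ inv r ⟧R d e = role I r e d

  ⟦_⟧chain : List Role → Dom I → Dom I → Set
  ⟦ [] ⟧chain d e = d ≡ e
  ⟦ r ∷ w ⟧chain d e = Σ (Dom I) λ m → ⟦ r ⟧R d m × ⟦ w ⟧chain m e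

  AtLeast : ℕ → Role → (Dom I → Set) → Dom I → Set
  AtLeast n s P d = Σ (Fin n → Dom I) λ f →
    Injective _≡_ _≡_ f × (∀ i → ⟦ s ⟧R d (f i) × P (f i))

  ⟦_⟧ : Concept → Dom I → Set
  ⟦ atom A ⟧ d = conc I A d
  ⟦ neg A ⟧ d = ¬ conc I A d
  ⟦ C ⊔ D ⟧ d = ⟦ C ⟧ d ⊎ ⟦ D ⟧ d
  ⟦ C ⊓ D ⟧ d = ⟦ C ⟧ d × ⟦ D ⟧ d
  ⟦ ex r C ⟧ d = Σ (Dom I) λ e → ⟦ r ⟧R d e × ⟦ C ⟧ e
  ⟦ all r C ⟧ d = ∀ e → ⟦ r ⟧R d e → ⟦ C ⟧ e
  ⟦ atMost n s C ⟧ d = ¬ AtLeast (suc n) s ⟦ C ⟧ d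
  ⟦ atLeast n s C ⟧ d = AtLeast n s ⟦ C ⟧ d

  SatRIA : RIA → Set
  SatRIA (w ⊑ s) = ∀ d e → ⟦ w ⟧chain d e → ⟦ s ⟧R d e

  SatGCI : Concept → Set
  SatGCI C = ∀ d → ⟦ C ⟧ d

  Models : Ontology → Set
  Models O = All SatRIA (rbox O) × All SatGCI (tbox O)

data SAtom : Set where
  rel : Role → Label → Label → SAtom
  eq  : Label → Label → SAtom
  neq : Label → Label → SAtom

LConcept : Set
LConcept = Label × Concept

Antecedent Succedent : Set
Antecedent = List SAtom     -- a set, represented as a list (only membership is used)
Succedent = List LConcept   -- a multiset, represented as a list up to permutation

labelsA : SAtom → List Label
labelsA (rel r x y) = x ∷ y ∷ []
labelsA (eq x y) = x ∷ y ∷ []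
labelsA (neq x y) = x ∷ y ∷ []

Fresh : Label → Antecedent → Succedent → Set
Fresh y Γ Δ = All (λ a → y ∉ labelsA a) Γ × All (λ p → proj₁ p ≢ y) Δ

GCI : Ontology → Label → Succedent
GCI O y = map (λ C → (y , ¬̇ C)) (tbox O)

allNeq : List Label → Antecedent
allNeq [] = []
allNeq (y ∷ ys) = map (neq y) ys ++ allNeq ys

allEqPairs : List Label → Antecedent
allEqPairs [] = []
allEqPairs (y ∷ ys) = map (eq y) ys ++ allEqPairs ys

EqAtom : Antecedent → Rel Label 0ℓ
EqAtom Γ x y = eq x y ∈ Γ

_⊢_=*_ : Antecedent → Label → Label → Set
Γ ⊢ x =* y = Star (SymClosure (EqAtom Γ)) x y

Edge : Antecedent → Role → Label → Label → Set
Edge Γ t a b = Σ Role λ r → Σ Label λ z → Σ Label λ w → rel r z w ∈ Γ ×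
  ((r ≡ t × Γ ⊢ a =* z × Γ ⊢ w =* b) ⊎ (Inv r ≡ t × Γ ⊢ a =* w × Γ ⊢ z =* b))

PathS : Antecedent → List Role → Label → Label → Set
PathS Γ [] x y = Γ ⊢ x =* y
PathS Γ (t ∷ S) x y = Σ Label λ z → Edge Γ t x z × PathS Γ S z y

Production : Ontology → Role → List Role → Set
Production O t T = Any (λ ria → (t ≡ rhs ria × T ≡ lhs ria)
                               ⊎ (t ≡ Inv (rhs ria) × T ≡ reverse (map Inv (lhs ria))))
                       (rbox O)

Rewrite : Ontology → List Role → List Role → Set
Rewrite O u v = Σ (List Role) λ u₁ → Σ (List Role) λ u₂ → Σ Role λ t → Σ (List Role) λ T →
  Production O t T × u ≡ u₁ ++ t ∷ u₂ × v ≡ u₁ ++ T ++ u₂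

L : Ontology → Role → List Role → Set
L O r S = Star (Rewrite O) (r ∷ []) S

Reach : Ontology → Antecedent → Role → Label → Label → Set
Reach O Γ r x y = Σ (List Role) λ S → L O r S × PathS Γ S x y

-- The calculus S(O).  Principal formulas are written at the head of
-- the succedent; the rules `perm` and `setEq` only identify list
-- representations of the same multiset / set.

data Proves (O : Ontology) : Antecedent → Succedent → Set where
  perm  : ∀ {Γ Δ Δ′} → Proves O Γ Δ → Δ ↭ Δ′ → Proves O Γ Δ′
  setEq : ∀ {Γ Γ′ Δ} → Proves O Γ Δ → (∀ {a} → a ∈ Γ → a ∈ Γ′)
        → (∀ {a} → a ∈ Γ′ → a ∈ Γ) → Proves O Γ′ Δ
  id    : ∀ {Γ Δ x A} → Proves O Γ ((x , atom A) ∷ (x , neg A) ∷ Δ)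
  id≐   : ∀ {Γ Δ x y} → (neq x y ∷ Γ) ⊢ x =* y → Proves O (neq x y ∷ Γ) Δ
  s≐    : ∀ {Γ Δ x y C} → Literal C → Γ ⊢ x =* y
        → Proves O Γ ((x , C) ∷ (y , C) ∷ Δ) → Proves O Γ ((x , C) ∷ Δ)
  ⊔R    : ∀ {Γ Δ x C D} → Proves O Γ ((x , C) ∷ (x , D) ∷ Δ)
        → Proves O Γ ((x , C ⊔ D) ∷ Δ)
  ⊓R    : ∀ {Γ Δ x C D} → Proves O Γ ((x , C) ∷ Δ) → Proves O Γ ((x , D) ∷ Δ)
        → Proves O Γ ((x , C ⊓ D) ∷ Δ)
  ∃R    : ∀ {Γ Δ x y r C} → Reach O Γ r x y
        → Proves O Γ ((x , ex r C) ∷ (y , C) ∷ Δ) → Proves O Γ ((x , ex r C) ∷ Δ)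
  ∀R    : ∀ {Γ Δ x y r C} → Fresh y Γ ((x , all r C) ∷ Δ)
        → Proves O (rel r x y ∷ Γ) ((y , C) ∷ GCI O y ++ Δ)
        → Proves O Γ ((x , all r C) ∷ Δ)
  ≤R    : ∀ {Γ Δ x n r C} (ys : List Label) → length ys ≡ suc n → Unique ys
        → All (λ y → Fresh y Γ ((x , atMost n r C) ∷ Δ)) ys
        → Proves O (allNeq ys ++ map (rel r x) ys ++ Γ)
                   (concatMap (λ y → (y , ¬̇ C) ∷ GCI O y) ys ++ Δ)
        → Proves O Γ ((x , atMost n r C) ∷ Δ)
  ≥R    : ∀ {Γ Δ x n r C} (ys : List Label) → length ys ≡ n
        → All (Reach O Γ r x) ys
        → (∀ {y} → y ∈ ys → Proves O Γ ((y , C) ∷ (x , atLeast n r C) ∷ Δ))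
        → (∀ {a} → a ∈ allEqPairs ys → Proves O (a ∷ Γ) ((x , atLeast n r C) ∷ Δ))
        → Proves O Γ ((x , atLeast n r C) ∷ Δ)

SatAtom : (I : Interpretation) → (Label → Dom I) → SAtom → Set
SatAtom I λ′ (rel r x y) = ⟦ I ⟧R r (λ′ x) (λ′ y)
SatAtom I λ′ (eq x y) = λ′ x ≡ λ′ y
SatAtom I λ′ (neq x y) = λ′ x ≢ λ′ y

Valid : Ontology → Antecedent → Succedent → Set₁
Valid O Γ Δ = (I : Interpretation) → Models I O → (λ′ : Label → Dom I)
  → All (SatAtom I λ′) Γ → Any (λ p → ⟦ I ⟧ (proj₂′ p) (λ′ (proj₁ p))) Δ
  where proj₂′ : LConcept → Concept
        proj₂′ (_ , C) = C

module Submission where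

-- Completeness by saturation.  If  ⊢ x:GCI(O), x:C  has no proof, excluded middle lets us grow
-- an infinite branch of unprovable sequents.  A first-in-first-out queue decomposes every
-- formula of the branch once (the ∀ and ≤ rules introduce fresh labels together with their
-- GCI formulas), while the persistent formulas (literals, ∃, ≥), which their rules never
-- consume, are fired again and again at every list of labels following a fair schedule.
-- The limit of the branch is a Hintikka structure.  Its canonical model, whose elements are
-- the classes of labels identified by equality atoms and whose roles are the closure of the
-- propagation graph under the R-system, satisfies O and falsifies every formula on the
-- branch; in particular it falsifies x:C, so the sequent ⊢ x:C is not valid.

open import Defs
open import Level using (0ℓ)
open import Axiom.ExcludedMiddle using (ExcludedMiddle)
open import Axiom.DoubleNegationElimination using (em⇒dne)
open import Data.Bool.Properties using (T-irrelevant)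
open import Data.Empty using (⊥; ⊥-elim)
open import Data.Unit using (⊤; tt)
open import Data.Fin using (Fin; toℕ)
open import Data.Fin.Properties using (toℕ-injective) renaming (_≟_ to _≟ᶠ_; suc-injective to suc-injectiveᶠ)
open import Data.Nat using (ℕ; zero; suc; _+_; _∸_; _≤_; _<_; _≤′_; ≤′-refl; ≤′-step; _<?_; z≤n; s≤s)
  renaming (_⊔_ to _⊔ₙ_)
open import Data.Nat.Induction using (<-rec)
open import Data.Nat.Properties
open import Data.Product using (Σ; ∃; ∃₂; _×_; _,_; proj₁; proj₂)
import Data.Product as Product
open import Data.Maybe using (Maybe; just; nothing)
open import Data.Sum using (_⊎_; inj₁; inj₂)
import Data.Sum as Sum
open import Data.List using (List; []; _∷_; _++_; [_]; map; reverse; length; concatMap; drop; tabulate)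
open import Data.List.Properties using (++-assoc; ++-identityʳ; map-++; reverse-++; reverse-map; reverse-involutive; length-tabulate)
open import Data.List.Extrema.Nat using (max; xs≤max)
open import Data.List.Membership.Propositional using (_∈_)
open import Data.List.Membership.Propositional.Properties
open import Data.List.Relation.Binary.Subset.Propositional using (_⊆_)
open import Data.List.Relation.Binary.Permutation.Propositional using (_↭_; ↭-sym; ↭-trans; ↭-refl; ↭-reflexive; ↭-prep; ↭-swap)
open import Data.List.Relation.Binary.Permutation.Propositional.Properties using (shift; shifts; ∷↭∷ʳ; ++⁺ˡ; All-resp-↭; ∈-resp-↭)
open import Data.List.Relation.Unary.All using (All; []; _∷_)
import Data.List.Relation.Unary.All as All
import Data.List.Relation.Unary.All.Properties as All
open import Data.List.Relation.Unary.Any using (Any; here; there)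
import Data.List.Relation.Unary.Any as Any
import Data.List.Relation.Unary.Any.Properties as Any
open import Data.List.Relation.Unary.Unique.Propositional.Properties using (tabulate⁺)
open import Relation.Binary.Construct.Closure.Symmetric using (fwd)
open import Relation.Binary.Construct.Closure.ReflexiveTransitive using (Star; ε; _◅_; _◅◅_)
import Relation.Binary.Construct.Closure.Equivalence as EqClosure
open import Relation.Binary.PropositionalEquality using (_≡_; _≢_; refl; sym; trans; cong; cong₂; subst; subst₂; module ≡-Reasoning)
open import Function using (_∘_)
open import Relation.Nullary using (¬_; yes; no)
open import Relation.Nullary.Decidable using (True; toWitness; fromWitness)

private
  variable
    A : Set
    Γ Γ′ : Antecedent
    x y z w : Label

∈⇒↭∷ : ∀ {v : A} {xs} → v ∈ xs → ∃ λ rest → xs ↭ v ∷ rest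
∈⇒↭∷ {v = v} v∈xs with ys , zs , refl ← ∈-∃++ v∈xs = ys ++ zs , shift v ys zs

nth : List A → ℕ → Maybe A
nth []       _       = nothing
nth (v ∷ _)  zero    = just v
nth (_ ∷ vs) (suc i) = nth vs i

nth-∈ : ∀ {xs : List A} {i v} → nth xs i ≡ just v → v ∈ xs
nth-∈ {xs = _ ∷ _} {zero}  refl = here refl
nth-∈ {xs = _ ∷ _} {suc i} found = there (nth-∈ found)

nth-++ : ∀ (xs : List A) {ys i v} → nth xs i ≡ just v → nth (xs ++ ys) i ≡ just v
nth-++ (_ ∷ _)  {i = zero}  found = found
nth-++ (_ ∷ xs) {i = suc i} found = nth-++ xs found

∈⇒nth : ∀ {xs : List A} {v} → v ∈ xs → ∃ λ i → nth xs i ≡ just v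
∈⇒nth (here refl) = zero , refl
∈⇒nth (there v∈xs) with i , found ← ∈⇒nth v∈xs = suc i , found

allNeq-tabulate : ∀ {n} (f : Fin n → Label) {i j} → i ≢ j
  → neq (f i) (f j) ∈ allNeq (tabulate f) ⊎ neq (f j) (f i) ∈ allNeq (tabulate f)
allNeq-tabulate f {Fin.zero} {Fin.zero} i≢j = ⊥-elim (i≢j refl)
allNeq-tabulate f {Fin.zero} {Fin.suc j} _ = inj₁ (∈-++⁺ˡ (∈-map⁺ (neq (f Fin.zero)) (∈-tabulate⁺ j)))
allNeq-tabulate f {Fin.suc i} {Fin.zero} _ = inj₂ (∈-++⁺ˡ (∈-map⁺ (neq (f Fin.zero)) (∈-tabulate⁺ i)))
allNeq-tabulate f {Fin.suc i} {Fin.suc j} i≢j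
  with allNeq-tabulate (λ k → f (Fin.suc k)) (λ i≡j → i≢j (cong Fin.suc i≡j))
... | inj₁ p = inj₁ (∈-++⁺ʳ _ p)
... | inj₂ p = inj₂ (∈-++⁺ʳ _ p)

∈-allEqPairs-tabulate : ∀ {n} (f : Fin n → Label) {a} → a ∈ allEqPairs (tabulate f)
  → ∃₂ λ i j → i ≢ j × a ≡ eq (f i) (f j)
∈-allEqPairs-tabulate {suc n} f a∈ with ∈-++⁻ (map (eq (f Fin.zero)) (tabulate (λ k → f (Fin.suc k)))) a∈
... | inj₁ p with v , v∈ , refl ← ∈-map⁻ (eq (f Fin.zero)) p with j , refl ← ∈-tabulate⁻ v∈
  = Fin.zero , Fin.suc j , (λ ()) , refl
... | inj₂ p with i , j , i≢j , refl ← ∈-allEqPairs-tabulate (λ k → f (Fin.suc k)) p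
  = Fin.suc i , Fin.suc j , (λ si≡sj → i≢j (suc-injectiveᶠ si≡sj)) , refl

freshLabel : Antecedent → Succedent → Label
freshLabel Γ Δ = suc (max 0 (concatMap labelsA Γ ++ map proj₁ Δ))

freshLabel-Fresh : ∀ Γ Δ {y} → freshLabel Γ Δ ≤ y → Fresh y Γ Δ
freshLabel-Fresh Γ Δ {y} fresh≤y =
  All.tabulate (λ a∈Γ y∈a → below (∈-++⁺ˡ (∈-concatMap⁺ labelsA (Any.map (λ { refl → y∈a }) a∈Γ)))) ,
  All.tabulate (λ { p∈Δ refl → below (∈-++⁺ʳ _ (∈-map⁺ proj₁ p∈Δ)) })
  where
  below : y ∈ concatMap labelsA Γ ++ map proj₁ Δ → ⊥
  below y∈ = <-irrefl refl (≤-<-trans (All.lookup (xs≤max 0 _) y∈) fresh≤y)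

block : Label → (n : ℕ) → Fin n → Label
block m n i = m + toℕ i

block-injective : ∀ m n {i j} → block m n i ≡ block m n j → i ≡ j
block-injective m n same = toℕ-injective (+-cancelˡ-≡ m _ _ same)

block-Fresh : ∀ Γ Δ n → All (λ y → Fresh y Γ Δ) (tabulate (block (freshLabel Γ Δ) n))
block-Fresh Γ Δ n = All.tabulate⁺ (λ i → freshLabel-Fresh Γ Δ (m≤m+n _ _))

-- A fair schedule

triangle : ℕ → ℕ
triangle zero    = zero
triangle (suc j) = triangle j + suc j

n≤triangle : ∀ j → j ≤ triangle j
n≤triangle zero    = z≤n
n≤triangle (suc j) = m≤n+m (suc j) (triangle j)

zigzagStep : ℕ × ℕ → ℕ × ℕ
zigzagStep (c , n) with c <? n
... | yes _ = suc c , n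
... | no _  = zero , suc n

-- Cantor's walk (0,0), (0,1), (1,1), (0,2), (1,2), (2,2), … through {(c , n) | c ≤ n}.
zigzag : ℕ → ℕ × ℕ
zigzag zero    = zero , zero
zigzag (suc k) = zigzagStep (zigzag k)

zigzagStep-< : ∀ {c n} → c < n → zigzagStep (c , n) ≡ (suc c , n)
zigzagStep-< {c} {n} c<n with c <? n
... | yes _   = refl
... | no c≮n = ⊥-elim (c≮n c<n)

zigzagStep-diagonal : ∀ n → zigzagStep (n , n) ≡ (zero , suc n)
zigzagStep-diagonal n with n <? n
... | yes n<n = ⊥-elim (<-irrefl refl n<n)
... | no _    = refl

zigzag-triangle : ∀ j d → d ≤ j → zigzag (triangle j + d) ≡ (d , j)
zigzag-triangle zero    zero    _   = refl
zigzag-triangle (suc j) zero    _   = begin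
  zigzag (triangle j + suc j + 0)      ≡⟨ cong zigzag (trans (+-identityʳ _) (+-suc (triangle j) j)) ⟩
  zigzagStep (zigzag (triangle j + j)) ≡⟨ cong zigzagStep (zigzag-triangle j j ≤-refl) ⟩
  zigzagStep (j , j)                   ≡⟨ zigzagStep-diagonal j ⟩
  (zero , suc j)                       ∎
  where open ≡-Reasoning
zigzag-triangle j       (suc d) d<j = begin
  zigzag (triangle j + suc d)          ≡⟨ cong zigzag (+-suc (triangle j) d) ⟩
  zigzagStep (zigzag (triangle j + d)) ≡⟨ cong zigzagStep (zigzag-triangle j d (<⇒≤ d<j)) ⟩
  zigzagStep (d , j)                   ≡⟨ zigzagStep-< d<j ⟩
  (suc d , j)                          ∎
  where open ≡-Reasoning

zigzag-fair : ∀ c k₀ → ∃ λ k → k₀ ≤ k × proj₁ (zigzag k) ≡ c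
zigzag-fair c k₀ =
  triangle (k₀ + c) + c ,
  ≤-trans (m≤m+n k₀ c) (≤-trans (n≤triangle (k₀ + c)) (m≤m+n _ c)) ,
  cong proj₁ (zigzag-triangle (k₀ + c) c (m≤n+m c k₀))

pair : ℕ → ℕ → ℕ
pair a b = triangle (a + b) + a

unpair : ℕ → ℕ × ℕ
unpair k = proj₁ (zigzag k) , proj₂ (zigzag k) ∸ proj₁ (zigzag k)

unpair-pair : ∀ a b → unpair (pair a b) ≡ (a , b)
unpair-pair a b rewrite zigzag-triangle (a + b) a (m≤m+n a b) = cong (a ,_) (m+n∸m≡n a b)

encodeList : List ℕ → ℕ
encodeList []       = zero
encodeList (a ∷ as) = pair a (encodeList as)

decodeList : (len code : ℕ) → List ℕ
decodeList zero      _    = []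
decodeList (suc len) code = proj₁ (unpair code) ∷ decodeList len (proj₂ (unpair code))

decodeList-encodeList : ∀ as → decodeList (length as) (encodeList as) ≡ as
decodeList-encodeList []       = refl
decodeList-encodeList (a ∷ as) = trans
  (cong (λ p → proj₁ p ∷ decodeList (length as) (proj₂ p)) (unpair-pair a (encodeList as)))
  (cong (a ∷_) (decodeList-encodeList as))

-- A task asks to propagate the i-th persistent formula of the branch to the labels ys.
Task : Set
Task = ℕ × List Label

decodeTask : ℕ → Task
decodeTask code = proj₁ (unpair code) , decodeList (proj₁ (unpair rest)) (proj₂ (unpair rest))
  where
  rest : ℕ
  rest = proj₂ (unpair code)

decodeTask-surjective : ∀ t → ∃ λ code → decodeTask code ≡ t
decodeTask-surjective (i , ys) = pair i (pair (length ys) (encodeList ys)) , (begin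
  decodeTask (pair i (pair (length ys) (encodeList ys)))
    ≡⟨ cong (λ p → proj₁ p , decodeList (proj₁ (unpair (proj₂ p))) (proj₂ (unpair (proj₂ p))))
            (unpair-pair i _) ⟩
  i , decodeList (proj₁ (unpair (pair (length ys) (encodeList ys))))
                 (proj₂ (unpair (pair (length ys) (encodeList ys))))
    ≡⟨ cong (λ p → i , decodeList (proj₁ p) (proj₂ p)) (unpair-pair (length ys) (encodeList ys)) ⟩
  i , decodeList (length ys) (encodeList ys)
    ≡⟨ cong (i ,_) (decodeList-encodeList ys) ⟩
  i , ys ∎)
  where open ≡-Reasoning

schedule : ℕ → Task
schedule k = decodeTask (proj₁ (zigzag k))

schedule-fair : ∀ t k₀ → ∃ λ k → k₀ ≤ k × schedule k ≡ t
schedule-fair t k₀ with code , decoded ← decodeTask-surjective t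
                   with k , k₀≤k , hit ← zigzag-fair code k₀ = k , k₀≤k , trans (cong decodeTask hit) decoded

Least : (ℕ → Set) → ℕ → Set
Least P m = P m × (∀ k → P k → m ≤ k)

least : ExcludedMiddle 0ℓ → ∀ {P : ℕ → Set} {n} → P n → ∃ (Least P)
least lem {P} {n} = <-rec (λ n → P n → ∃ (Least P)) search n
  where
  search : ∀ n → (∀ {m} → m < n → P m → ∃ (Least P)) → P n → ∃ (Least P)
  search n smaller pn with lem {∃ λ m → m < n × P m}
  ... | yes (m , m<n , pm) = smaller m<n pm
  ... | no none = n , pn , λ k pk → ≮⇒≥ (λ k<n → none (k , k<n , pk))

Least-unique : ∀ {P Q : ℕ → Set} {m n} → (∀ {k} → P k → Q k) → (∀ {k} → Q k → P k)
  → Least P m → Least Q n → m ≡ n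
Least-unique P⇒Q Q⇒P (pm , m≤) (qn , n≤) = ≤-antisym (m≤ _ (Q⇒P qn)) (n≤ _ (P⇒Q pm))

Inv-involutive : ∀ r → Inv (Inv r) ≡ r
Inv-involutive (rn _)  = refl
Inv-involutive (inv _) = refl

Inv* : List Role → List Role
Inv* w = reverse (map Inv w)

Inv*-++ : ∀ u v → Inv* (u ++ v) ≡ Inv* v ++ Inv* u
Inv*-++ u v = trans (cong reverse (map-++ Inv u v)) (reverse-++ (map Inv u) (map Inv v))

Inv*-involutive : ∀ w → Inv* (Inv* w) ≡ w
Inv*-involutive w = begin
  reverse (map Inv (reverse (map Inv w))) ≡⟨ cong reverse (reverse-map Inv (map Inv w)) ⟩
  reverse (reverse (map Inv (map Inv w))) ≡⟨ reverse-involutive _ ⟩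
  map Inv (map Inv w)                     ≡⟨ map-Inv-Inv w ⟩
  w                                       ∎
  where
  open ≡-Reasoning
  map-Inv-Inv : ∀ w → map Inv (map Inv w) ≡ w
  map-Inv-Inv []      = refl
  map-Inv-Inv (r ∷ w) = cong₂ _∷_ (Inv-involutive r) (map-Inv-Inv w)

=*-sym : Γ ⊢ x =* y → Γ ⊢ y =* x
=*-sym = EqClosure.symmetric (EqAtom _)

=*-mono : Γ ⊆ Γ′ → Γ ⊢ x =* y → Γ′ ⊢ x =* y
=*-mono Γ⊆Γ′ = EqClosure.map Γ⊆Γ′

edge-mono : ∀ {t} → Γ ⊆ Γ′ → Edge Γ t x y → Edge Γ′ t x y
edge-mono Γ⊆ (r , a , b , r∈ , inj₁ (e , p , q)) = r , a , b , Γ⊆ r∈ , inj₁ (e , =*-mono Γ⊆ p , =*-mono Γ⊆ q)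
edge-mono Γ⊆ (r , a , b , r∈ , inj₂ (e , p , q)) = r , a , b , Γ⊆ r∈ , inj₂ (e , =*-mono Γ⊆ p , =*-mono Γ⊆ q)

edge-=*ˡ : ∀ {t} → Γ ⊢ x =* y → Edge Γ t y z → Edge Γ t x z
edge-=*ˡ x=y (r , a , b , r∈ , inj₁ (e , p , q)) = r , a , b , r∈ , inj₁ (e , x=y ◅◅ p , q)
edge-=*ˡ x=y (r , a , b , r∈ , inj₂ (e , p , q)) = r , a , b , r∈ , inj₂ (e , x=y ◅◅ p , q)

edge-Inv : ∀ {t} → Edge Γ t x y → Edge Γ (Inv t) y x
edge-Inv (r , a , b , r∈ , inj₁ (refl , p , q)) = r , a , b , r∈ , inj₂ (refl , =*-sym q , =*-sym p)
edge-Inv (r , a , b , r∈ , inj₂ (refl , p , q)) = r , a , b , r∈ , inj₁ (sym (Inv-involutive r) , =*-sym q , =*-sym p)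

path-mono : ∀ S → Γ ⊆ Γ′ → PathS Γ S x y → PathS Γ′ S x y
path-mono []      Γ⊆ p           = =*-mono Γ⊆ p
path-mono (_ ∷ S) Γ⊆ (m , e , p) = m , edge-mono Γ⊆ e , path-mono S Γ⊆ p

path-=*ˡ : ∀ S → Γ ⊢ x =* y → PathS Γ S y z → PathS Γ S x z
path-=*ˡ []      x=y p           = x=y ◅◅ p
path-=*ˡ (_ ∷ _) x=y (m , e , p) = m , edge-=*ˡ x=y e , p

path-=*ʳ : ∀ S → PathS Γ S x y → Γ ⊢ y =* z → PathS Γ S x z
path-=*ʳ []      p           y=z = p ◅◅ y=z
path-=*ʳ (_ ∷ S) (m , e , p) y=z = m , e , path-=*ʳ S p y=z

path-++ : ∀ S T → PathS Γ S x y → PathS Γ T y z → PathS Γ (S ++ T) x z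
path-++ []      T p           q = path-=*ˡ T p q
path-++ (_ ∷ S) T (m , e , p) q = m , e , path-++ S T p q

path-Inv* : ∀ S → PathS Γ S x y → PathS Γ (Inv* S) y x
path-Inv* []      p = =*-sym p
path-Inv* {Γ} {x} {y} (t ∷ S) (m , e , p) = subst (λ T → PathS Γ T y x) (sym (Inv*-++ [ t ] S))
  (path-++ (Inv* S) [ Inv t ] (path-Inv* S p) (x , edge-Inv e , ε))

module Derivations (O : Ontology) where

  _⇒*_ : List Role → List Role → Set
  _⇒*_ = Star (Rewrite O)

  rewrite-inContext : ∀ p q {u v} → Rewrite O u v → Rewrite O (p ++ u ++ q) (p ++ v ++ q)
  rewrite-inContext p q (u₁ , u₂ , t , T , t→T , refl , refl) =
    p ++ u₁ , u₂ ++ q , t , T , t→T ,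
    trans (cong (p ++_) (++-assoc u₁ (t ∷ u₂) q)) (sym (++-assoc p u₁ (t ∷ u₂ ++ q))) ,
    trans (cong (p ++_) (trans (++-assoc u₁ (T ++ u₂) q) (cong (u₁ ++_) (++-assoc T u₂ q))))
          (sym (++-assoc p u₁ (T ++ u₂ ++ q)))

  ⇒*-inContext : ∀ p q {u v} → u ⇒* v → (p ++ u ++ q) ⇒* (p ++ v ++ q)
  ⇒*-inContext p q ε           = ε
  ⇒*-inContext p q (step ◅ ⇒v) = rewrite-inContext p q step ◅ ⇒*-inContext p q ⇒v

  ⇒*-++ : ∀ {u u′ v v′} → u ⇒* u′ → v ⇒* v′ → (u ++ v) ⇒* (u′ ++ v′)
  ⇒*-++ {u} {u′} {v} {v′} u⇒ v⇒ = ⇒*-inContext [] v u⇒ ◅◅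
    subst₂ _⇒*_ (cong (u′ ++_) (++-identityʳ v)) (cong (u′ ++_) (++-identityʳ v′)) (⇒*-inContext u′ [] v⇒)

  production-Inv : ∀ {t T} → Production O t T → Production O (Inv t) (Inv* T)
  production-Inv = Any.map dual
    where
    dual : ∀ {ria t T} → (t ≡ rhs ria × T ≡ lhs ria) ⊎ (t ≡ Inv (rhs ria) × T ≡ Inv* (lhs ria))
      → (Inv t ≡ rhs ria × Inv* T ≡ lhs ria) ⊎ (Inv t ≡ Inv (rhs ria) × Inv* T ≡ Inv* (lhs ria))
    dual (inj₁ (refl , refl)) = inj₂ (refl , refl)
    dual {ria} (inj₂ (refl , refl)) = inj₁ (Inv-involutive (rhs ria) , Inv*-involutive (lhs ria))

  rewrite-Inv : ∀ {u v} → Rewrite O u v → Rewrite O (Inv* u) (Inv* v)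
  rewrite-Inv (u₁ , u₂ , t , T , t→T , refl , refl) =
    Inv* u₂ , Inv* u₁ , Inv t , Inv* T , production-Inv t→T ,
    trans (Inv*-++ u₁ (t ∷ u₂)) (trans (cong (_++ Inv* u₁) (Inv*-++ [ t ] u₂)) (++-assoc (Inv* u₂) [ Inv t ] (Inv* u₁))) ,
    trans (Inv*-++ u₁ (T ++ u₂)) (trans (cong (_++ Inv* u₁) (Inv*-++ T u₂)) (++-assoc (Inv* u₂) (Inv* T) (Inv* u₁)))

  ⇒*-Inv : ∀ {u v} → u ⇒* v → Inv* u ⇒* Inv* v
  ⇒*-Inv ε           = ε
  ⇒*-Inv (step ◅ ⇒v) = rewrite-Inv step ◅ ⇒*-Inv ⇒v

  ReachW : Antecedent → List Role → Label → Label → Set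
  ReachW Γ w x y = ∃ λ S → w ⇒* S × PathS Γ S x y

  reachW-++ : ∀ {u v} → ReachW Γ u x y → ReachW Γ v y z → ReachW Γ (u ++ v) x z
  reachW-++ (S , u⇒S , p) (T , v⇒T , q) = S ++ T , ⇒*-++ u⇒S v⇒T , path-++ S T p q

  reachW-mono : ∀ {w} → Γ ⊆ Γ′ → ReachW Γ w x y → ReachW Γ′ w x y
  reachW-mono Γ⊆ (S , w⇒S , p) = S , w⇒S , path-mono S Γ⊆ p

  reachW-Inv : ∀ {w} → ReachW Γ w x y → ReachW Γ (Inv* w) y x
  reachW-Inv (S , w⇒S , p) = Inv* S , ⇒*-Inv w⇒S , path-Inv* S p

  reachW-resp : ∀ {w x′ y′} → Γ ⊢ x′ =* x → ReachW Γ w x y → Γ ⊢ y =* y′ → ReachW Γ w x′ y′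
  reachW-resp x′=x (S , w⇒S , p) y=y′ = S , w⇒S , path-=*ʳ S (path-=*ˡ S x′=x p) y=y′

  reach-rel : ∀ {r} → rel r x y ∈ Γ → Reach O Γ r x y
  reach-rel {x = x} {y} {r = r} r∈ = [ r ] , ε , y , (r , x , y , r∈ , inj₁ (refl , ε , ε)) , ε

  reach-ria : ∀ {w s} → (w ⊑ s) ∈ rbox O → ReachW Γ w x y → Reach O Γ s x y
  reach-ria {w = w} {s} ria∈ (S , w⇒S , p) = S , derive ◅ w⇒S , p
    where
    derive : Rewrite O [ s ] w
    derive = [] , [] , s , w , Any.map (λ { refl → inj₁ (refl , refl) }) ria∈ , refl , sym (++-identityʳ w)

-- Hintikka structures: what the limit of an unprovable branch satisfies

record Hintikka (O : Ontology) : Set₁ where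
  open Derivations O using (ReachW; reachW-++; reachW-mono; reachW-resp; reachW-Inv)
  field
    branch      : ℕ → Antecedent
    branch-mono : ∀ {k k′} → k ≤ k′ → branch k ⊆ branch k′
    Appears     : Label → Set
    Occurs      : Label → Concept → Set

  _≈_ : Label → Label → Set
  x ≈ y = ∃ λ k → branch k ⊢ x =* y

  ReachesW : List Role → Label → Label → Set
  ReachesW w x y = ∃ λ k → ReachW (branch k) w x y

  Reaches : Role → Label → Label → Set
  Reaches r = ReachesW [ r ]

  field
    occurs-appears : ∀ {z C} → Occurs z C → Appears z
    occurs-gci     : ∀ {z E} → Appears z → E ∈ tbox O → Occurs z (¬̇ E)
    no-clash       : ∀ {z A} → Occurs z (atom A) → Occurs z (neg A) → ⊥
    literal        : ∀ {z y L} → Literal L → Occurs z L → z ≈ y → Appears y → Occurs y L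
    ⊔-occurs       : ∀ {z C D} → Occurs z (C ⊔ D) → Occurs z C × Occurs z D
    ⊓-occurs       : ∀ {z C D} → Occurs z (C ⊓ D) → Occurs z C ⊎ Occurs z D
    ∃-occurs       : ∀ {z y r C} → Occurs z (ex r C) → Appears y → Reaches r z y → Occurs y C
    ∀-occurs       : ∀ {z r C} → Occurs z (all r C) → ∃ λ y → Reaches r z y × Occurs y C
    ≤-occurs       : ∀ {z n r C} → Occurs z (atMost n r C) → ∃ λ (ys : Fin (suc n) → Label) →
                       (∀ i → Reaches r z (ys i) × Occurs (ys i) (¬̇ C)) × (∀ {i j} → ys i ≈ ys j → i ≡ j)
    ≥-occurs       : ∀ {z n r C} → Occurs z (atLeast n r C) → (ys : Fin n → Label)
                       → (∀ i → Appears (ys i) × Reaches r z (ys i))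
                       → (∃ λ i → Occurs (ys i) C) ⊎ (∃₂ λ i j → i ≢ j × ys i ≈ ys j)

  ≈-refl : x ≈ x
  ≈-refl = zero , ε

  ≈-sym : x ≈ y → y ≈ x
  ≈-sym (k , x=y) = k , =*-sym x=y

  ≈-trans : x ≈ y → y ≈ z → x ≈ z
  ≈-trans (k , x=y) (k′ , y=z) = k ⊔ₙ k′ , =*-mono (branch-mono (m≤m⊔n k k′)) x=y ◅◅ =*-mono (branch-mono (m≤n⊔m k k′)) y=z

  reachesW-++ : ∀ {u v} → ReachesW u x y → ReachesW v y z → ReachesW (u ++ v) x z
  reachesW-++ (k , p) (k′ , q) =
    k ⊔ₙ k′ , reachW-++ (reachW-mono (branch-mono (m≤m⊔n k k′)) p) (reachW-mono (branch-mono (m≤n⊔m k k′)) q)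

  reachesW-respˡ : ∀ {w x′} → x′ ≈ x → ReachesW w x y → ReachesW w x′ y
  reachesW-respˡ (k , x′=x) (k′ , p) =
    k ⊔ₙ k′ , reachW-resp (=*-mono (branch-mono (m≤m⊔n k k′)) x′=x) (reachW-mono (branch-mono (m≤n⊔m k k′)) p) ε

  reachesW-respʳ : ∀ {w y′} → ReachesW w x y → y ≈ y′ → ReachesW w x y′
  reachesW-respʳ (k , p) (k′ , y=y′) =
    k ⊔ₙ k′ , reachW-resp ε (reachW-mono (branch-mono (m≤m⊔n k k′)) p) (=*-mono (branch-mono (m≤n⊔m k k′)) y=y′)

  reaches-Inv : ∀ {r} → Reaches r x y → Reaches (Inv r) y x
  reaches-Inv (k , p) = k , reachW-Inv p

-- The model of a Hintikka structure

-- Number restrictions weigh 3 because ¬̇ (≥ 0 s.C) = ⊥ has size 3; then size (¬̇ C) ≤ size C.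
size : Concept → ℕ
size (atom _)        = 1
size (neg _)         = 1
size (C ⊔ D)         = suc (size C + size D)
size (C ⊓ D)         = suc (size C + size D)
size (ex _ C)        = suc (size C)
size (all _ C)       = suc (size C)
size (atMost _ _ C)  = 3 + size C
size (atLeast _ _ C) = 3 + size C

size-positive : ∀ C → 1 ≤ size C
size-positive (atom _)        = s≤s z≤n
size-positive (neg _)         = s≤s z≤n
size-positive (_ ⊔ _)         = s≤s z≤n
size-positive (_ ⊓ _)         = s≤s z≤n
size-positive (ex _ _)        = s≤s z≤n
size-positive (all _ _)       = s≤s z≤n
size-positive (atMost _ _ _)  = s≤s z≤n
size-positive (atLeast _ _ _) = s≤s z≤n

size-¬̇ : ∀ C → size (¬̇ C) ≤ size C
size-¬̇ (atom _)               = ≤-refl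
size-¬̇ (neg _)                = ≤-refl
size-¬̇ (C ⊔ D)                = s≤s (+-mono-≤ (size-¬̇ C) (size-¬̇ D))
size-¬̇ (C ⊓ D)                = s≤s (+-mono-≤ (size-¬̇ C) (size-¬̇ D))
size-¬̇ (ex _ C)               = s≤s (size-¬̇ C)
size-¬̇ (all _ C)              = s≤s (size-¬̇ C)
size-¬̇ (atMost _ _ _)         = ≤-refl
size-¬̇ (atLeast zero _ _)     = s≤s (s≤s (s≤s z≤n))
size-¬̇ (atLeast (suc _) _ _)  = ≤-refl

module _ (lem : ExcludedMiddle 0ℓ) (I : Interpretation) where

  ¬⟦¬̇⟧⇒⟦⟧ : ∀ C {d} → ¬ ⟦ I ⟧ (¬̇ C) d → ⟦ I ⟧ C d
  ¬⟦¬̇⟧⇒⟦⟧ (atom A) {d} h with lem {conc I A d}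
  ... | yes c = c
  ... | no c  = ⊥-elim (h c)
  ¬⟦¬̇⟧⇒⟦⟧ (neg A) h = h
  ¬⟦¬̇⟧⇒⟦⟧ (C ⊔ D) {d} h with lem {⟦ I ⟧ (¬̇ C) d}
  ... | yes ¬c = inj₂ (¬⟦¬̇⟧⇒⟦⟧ D (λ ¬d → h (¬c , ¬d)))
  ... | no ¬¬c = inj₁ (¬⟦¬̇⟧⇒⟦⟧ C ¬¬c)
  ¬⟦¬̇⟧⇒⟦⟧ (C ⊓ D) h = ¬⟦¬̇⟧⇒⟦⟧ C (h ∘ inj₁) , ¬⟦¬̇⟧⇒⟦⟧ D (h ∘ inj₂)
  ¬⟦¬̇⟧⇒⟦⟧ (ex r C) {d} h with lem {∃ λ e → ⟦ I ⟧R r d e × ⟦ I ⟧ C e}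
  ... | yes witness = witness
  ... | no none     = ⊥-elim (h λ e re → ¬⟦⟧⇒⟦¬̇⟧ (λ c → none (e , re , c)))
    where
    ¬⟦⟧⇒⟦¬̇⟧ : ∀ {e} → ¬ ⟦ I ⟧ C e → ⟦ I ⟧ (¬̇ C) e
    ¬⟦⟧⇒⟦¬̇⟧ {e} ¬c with lem {⟦ I ⟧ (¬̇ C) e}
    ... | yes ¬̇c = ¬̇c
    ... | no ¬¬̇c = ⊥-elim (¬c (¬⟦¬̇⟧⇒⟦⟧ C ¬¬̇c))
  ¬⟦¬̇⟧⇒⟦⟧ (all r C) h e re = ¬⟦¬̇⟧⇒⟦⟧ C (λ ¬c → h (e , re , ¬c))
  ¬⟦¬̇⟧⇒⟦⟧ (atMost n s C) h = h
  ¬⟦¬̇⟧⇒⟦⟧ (atLeast zero s C) h = (λ ()) , (λ { {()} }) , λ ()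
  ¬⟦¬̇⟧⇒⟦⟧ (atLeast (suc n) s C) {d} h with lem {AtLeast I (suc n) s (⟦ I ⟧ C) d}
  ... | yes c = c
  ... | no c  = ⊥-elim (h c)

module CanonicalModel (lem : ExcludedMiddle 0ℓ) {O : Ontology} (H : Hintikka O) where
  open Hintikka H

  -- Elements are the least appearing labels of their ≈-classes.
  ClassOf : Label → ℕ → Set
  ClassOf z m = Appears m × m ≈ z

  IsCanonical : Label → Set
  IsCanonical d = Least (ClassOf d) d

  Element : Set
  Element = Σ Label λ d → True (lem {IsCanonical d})

  label : Element → Label
  label = proj₁

  canonical : (d : Element) → IsCanonical (label d)
  canonical d = toWitness (proj₂ d)

  appears : (d : Element) → Appears (label d)
  appears d = proj₁ (proj₁ (canonical d))

  label-injective : ∀ {d e : Element} → label d ≡ label e → d ≡ e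
  label-injective {d , p} {.d , q} refl = cong (d ,_) (T-irrelevant p q)

  ClassOf-≈ : z ≈ w → ∀ {m} → ClassOf z m → ClassOf w m
  ClassOf-≈ z≈w (ap , m≈z) = ap , ≈-trans m≈z z≈w

  canonical-≈ : ∀ {d e : Element} → label d ≈ label e → d ≡ e
  canonical-≈ {d} {e} d≈e = label-injective
    (Least-unique (ClassOf-≈ d≈e) (ClassOf-≈ (≈-sym d≈e)) (canonical d) (canonical e))

  Least-canonical : ∀ {z m} → Least (ClassOf z) m → IsCanonical m
  Least-canonical ((ap , m≈z) , minimal) = (ap , ≈-refl) , λ k k∈ → minimal k (ClassOf-≈ m≈z k∈)

  representative : ∀ z → Appears z → ∃ (Least (ClassOf z))
  representative z ap = least lem (ap , ≈-refl)

  [_∣_] : ∀ z → Appears z → Element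
  [ z ∣ ap ] = let m , m-least = representative z ap in m , fromWitness (Least-canonical m-least)

  label-≈ : ∀ {z} ap → label [ z ∣ ap ] ≈ z
  label-≈ {z} ap = proj₂ (proj₁ (proj₂ (representative z ap)))

  [label] : (d : Element) → ∀ {ap} → [ label d ∣ ap ] ≡ d
  [label] d {ap} = canonical-≈ (label-≈ ap)

  model : Interpretation
  model = record
    { Dom  = Element
    ; conc = λ A d → ¬ Occurs (label d) (atom A)
    ; role = λ t d e → Reaches (rn t) (label d) (label e)
    }

  open Derivations O using (reach-ria)

  reaches⇒⟦⟧R : ∀ r {d e} → Reaches r (label d) (label e) → ⟦ model ⟧R r d e
  reaches⇒⟦⟧R (rn _)  h = h
  reaches⇒⟦⟧R (inv _) h = reaches-Inv h

  ⟦⟧R⇒reaches : ∀ r {d e} → ⟦ model ⟧R r d e → Reaches r (label d) (label e)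
  ⟦⟧R⇒reaches (rn _)  h = h
  ⟦⟧R⇒reaches (inv _) h = reaches-Inv h

  reaches-[] : ∀ {r} → Reaches r z y → ∀ apz apy → Reaches r (label [ z ∣ apz ]) (label [ y ∣ apy ])
  reaches-[] h apz apy = reachesW-respʳ (reachesW-respˡ (label-≈ apz) h) (≈-sym (label-≈ apy))

  -- The truth lemma, in contrapositive form.
  refute : ∀ {N} C {z} → size C ≤ N → Occurs z C → (ap : Appears z) → ¬ ⟦ model ⟧ C [ z ∣ ap ]
  refute {zero} C C≤0 _ _ _ with () ← ≤-trans (size-positive C) C≤0
  refute {suc N} (atom A) _ occ ap ¬occ = ¬occ (literal (lit+ A) occ (≈-sym (label-≈ ap)) (appears [ _ ∣ ap ]))
  refute {suc N} (neg A) _ occ ap ¬¬occ = ¬¬occ (λ occA → no-clash (literal (lit+ A) occA (label-≈ ap) ap) occ)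
  refute {suc N} (C ⊔ D) (s≤s le) occ ap (inj₁ c) = refute C (m+n≤o⇒m≤o _ le) (proj₁ (⊔-occurs occ)) ap c
  refute {suc N} (C ⊔ D) (s≤s le) occ ap (inj₂ d) = refute D (m+n≤o⇒n≤o _ le) (proj₂ (⊔-occurs occ)) ap d
  refute {suc N} (C ⊓ D) (s≤s le) occ ap (c , d) with ⊓-occurs occ
  ... | inj₁ occC = refute C (m+n≤o⇒m≤o _ le) occC ap c
  ... | inj₂ occD = refute D (m+n≤o⇒n≤o _ le) occD ap d
  refute {suc N} (ex r C) (s≤s le) occ ap (e , re , c) =
    refute C le (∃-occurs occ (appears e) (reachesW-respˡ (≈-sym (label-≈ ap)) (⟦⟧R⇒reaches r re)))
      (appears e) (subst (⟦ model ⟧ C) (sym ([label] e)) c)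
  refute {suc N} (all r C) (s≤s le) occ ap every with y , reach , occy ← ∀-occurs occ =
    refute C le occy apy (every [ y ∣ apy ] (reaches⇒⟦⟧R r (reaches-[] reach ap apy)))
    where
    apy : Appears y
    apy = occurs-appears occy
  refute {suc N} (atMost n r C) (s≤s le) occ ap ¬enough with ys , succ , distinct ← ≤-occurs occ =
    ¬enough (f , f-injective , λ i → reaches⇒⟦⟧R r (reaches-[] (proj₁ (succ i)) ap (ap-ys i)) , inC i)
    where
    ap-ys : ∀ i → Appears (ys i)
    ap-ys i = occurs-appears (proj₂ (succ i))
    f : Fin (suc n) → Element
    f i = [ ys i ∣ ap-ys i ]
    f-injective : ∀ {i j} → f i ≡ f j → i ≡ j
    f-injective {i} {j} fi≡fj =
      distinct (≈-trans (≈-sym (label-≈ (ap-ys i))) (subst (_≈ ys j) (cong label (sym fi≡fj)) (label-≈ (ap-ys j))))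
    inC : ∀ i → ⟦ model ⟧ C (f i)
    inC i = ¬⟦¬̇⟧⇒⟦⟧ lem model C (refute (¬̇ C) (≤-trans (size-¬̇ C) (m+n≤o⇒n≤o 2 le)) (proj₂ (succ i)) (ap-ys i))
  refute {suc N} (atLeast n r C) (s≤s le) occ ap (f , f-injective , succ)
    with ≥-occurs occ (label ∘ f) (λ i → appears (f i) , reachesW-respˡ (≈-sym (label-≈ ap)) (⟦⟧R⇒reaches r (proj₁ (succ i))))
  ... | inj₁ (i , occC) = refute C (m+n≤o⇒n≤o 2 le) occC (appears (f i)) (subst (⟦ model ⟧ C) (sym ([label] (f i))) (proj₂ (succ i)))
  ... | inj₂ (i , j , i≢j , fi≈fj) = i≢j (f-injective (canonical-≈ fi≈fj))

  chain⇒reachesW : ∀ w {d e} → ⟦ model ⟧chain w d e → ReachesW w (label d) (label e)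
  chain⇒reachesW []      refl         = zero , [] , ε , ε
  chain⇒reachesW (r ∷ w) (_ , rm , me) = reachesW-++ (⟦⟧R⇒reaches r rm) (chain⇒reachesW w me)

  model-Models : Models model O
  model-Models = All.tabulate satRIA , All.tabulate satGCI
    where
    satRIA : ∀ {ria} → ria ∈ rbox O → SatRIA model ria
    satRIA {w ⊑ s} ria∈ d e chain with k , p ← chain⇒reachesW w chain = reaches⇒⟦⟧R s (k , reach-ria ria∈ p)
    satGCI : ∀ {E} → E ∈ tbox O → SatGCI model E
    satGCI {E} E∈ d = ¬⟦¬̇⟧⇒⟦⟧ lem model E λ ¬E →
      refute (¬̇ E) ≤-refl (occurs-gci (appears d) E∈) (appears d) (subst (⟦ model ⟧ (¬̇ E)) (sym ([label] d)) ¬E)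

  not-valid : ∀ {x C} → Occurs x C → Appears x → ¬ Valid O [] ((x , C) ∷ [])
  not-valid {x} {C} occ ap valid with valid model model-Models (λ _ → [ x ∣ ap ]) []
  ... | here c = refute C ≤-refl occ ap c

-- Saturating an unprovable sequent

-- The formulas whose rules keep the principal formula in the premise.
data Persistent : Concept → Set where
  atom    : ∀ A → Persistent (atom A)
  neg     : ∀ A → Persistent (neg A)
  ex      : ∀ r C → Persistent (ex r C)
  atLeast : ∀ n r C → Persistent (atLeast n r C)

withGCI : Ontology → Label → Concept → Succedent
withGCI O y C = (y , C) ∷ GCI O y

withGCI-label : ∀ O y C {p} → p ∈ withGCI O y C → proj₁ p ≡ y
withGCI-label O y C (here refl) = refl
withGCI-label O y C (there p∈) with _ , _ , refl ← ∈-map⁻ _ p∈ = refl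

↭-enqueue : ∀ (Q Y K : Succedent) → (Q ++ Y) ++ K ↭ Y ++ Q ++ K
↭-enqueue Q Y K = ↭-trans (↭-reflexive (++-assoc Q Y K)) (shifts Q Y)

↭-keep : ∀ (f : LConcept) Q K → Q ++ K ++ [ f ] ↭ f ∷ Q ++ K
↭-keep f Q K = ↭-trans (++⁺ˡ Q (↭-sym (∷↭∷ʳ f K))) (shift f Q K)

module Saturation (lem : ExcludedMiddle 0ℓ) (O : Ontology) where
  open Derivations O using (reach-rel; reachW-mono)

  -- The succedent is split into a queue of formulas still to be decomposed and the
  -- persistent formulas already seen, which are only ever appended to.
  record Stage : Set where
    constructor stage
    field
      atoms  : Antecedent
      queue  : Succedent
      kept   : Succedent
      labels : List Label

    Δ : Succedent
    Δ = queue ++ kept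
  open Stage

  record Open (s : Stage) : Set where
    field
      unprovable : ¬ Proves O (atoms s) (Δ s)
      labelled   : All (λ p → proj₁ p ∈ labels s) (Δ s)
      persistent : All (Persistent ∘ proj₂) (kept s)
  open Open

  record Extends (s s′ : Stage) : Set where
    constructor extension
    field
      atoms⊆      : atoms s ⊆ atoms s′
      kept-prefix : ∃ λ X → kept s′ ≡ kept s ++ X
      labels⊆     : labels s ⊆ labels s′
  open Extends

  Extends-refl : ∀ {s} → Extends s s
  Extends-refl {s} = extension (λ a∈ → a∈) ([] , sym (++-identityʳ (kept s))) (λ z∈ → z∈)

  Extends-trans : ∀ {s s′ s″} → Extends s s′ → Extends s′ s″ → Extends s s″
  Extends-trans {s} (extension a⊆ (X , refl) l⊆) (extension a⊆′ (X′ , refl) l⊆′) =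
    extension (a⊆′ ∘ a⊆) (X ++ X′ , ++-assoc (kept s) X X′) (l⊆′ ∘ l⊆)

  kept-mono : ∀ {s s′ f} → Extends s s′ → f ∈ kept s → f ∈ kept s′
  kept-mono (extension _ (_ , refl) _) f∈ = ∈-++⁺ˡ f∈

  HasGCI : Label → Succedent → Set
  HasGCI z Δ = All (λ E → (z , ¬̇ E) ∈ Δ) (tbox O)

  withGCI-HasGCI : ∀ y C → HasGCI y (withGCI O y C)
  withGCI-HasGCI y C = All.tabulate λ E∈ → there (∈-map⁺ _ E∈)

  -- What processing the head of the queue achieves.
  Decomposed : LConcept → Stage → Set
  Decomposed (z , C ⊔ D) s = (z , C) ∈ Δ s × (z , D) ∈ Δ s
  Decomposed (z , C ⊓ D) s = (z , C) ∈ Δ s ⊎ (z , D) ∈ Δ s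
  Decomposed (z , all r C) s = ∃ λ y → rel r z y ∈ atoms s × (y , C) ∈ Δ s
  Decomposed (z , atMost n r C) s = ∃ λ m → let ys = block m (suc n) in
    (∀ i → rel r z (ys i) ∈ atoms s × (ys i , ¬̇ C) ∈ Δ s) × allNeq (tabulate ys) ⊆ atoms s
  Decomposed (z , atom A) s = (z , atom A) ∈ kept s
  Decomposed (z , neg A) s = (z , neg A) ∈ kept s
  Decomposed (z , ex r C) s = (z , ex r C) ∈ kept s
  Decomposed (z , atLeast n r C) s = (z , atLeast n r C) ∈ kept s

  Decomposed-mono : ∀ {s s′} f → Extends s s′ → Δ s ⊆ Δ s′ → Decomposed f s → Decomposed f s′
  Decomposed-mono (_ , _ ⊔ _) _ Δ⊆ (c , d) = Δ⊆ c , Δ⊆ d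
  Decomposed-mono (_ , _ ⊓ _) _ Δ⊆ (inj₁ c) = inj₁ (Δ⊆ c)
  Decomposed-mono (_ , _ ⊓ _) _ Δ⊆ (inj₂ d) = inj₂ (Δ⊆ d)
  Decomposed-mono (_ , all _ _) ext Δ⊆ (y , r∈ , c) = y , atoms⊆ ext r∈ , Δ⊆ c
  Decomposed-mono (_ , atMost _ _ _) ext Δ⊆ (m , succ , neq⊆) =
    m , (λ i → atoms⊆ ext (proj₁ (succ i)) , Δ⊆ (proj₂ (succ i))) , atoms⊆ ext ∘ neq⊆
  Decomposed-mono (_ , atom _) ext _ f∈ = kept-mono ext f∈
  Decomposed-mono (_ , neg _) ext _ f∈ = kept-mono ext f∈
  Decomposed-mono (_ , ex _ _) ext _ f∈ = kept-mono ext f∈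
  Decomposed-mono (_ , atLeast _ _ _) ext _ f∈ = kept-mono ext f∈

  persistent-Decomposed : ∀ {s z C} → Persistent C → (z , C) ∈ kept s → Decomposed (z , C) s
  persistent-Decomposed (atom _)        f∈ = f∈
  persistent-Decomposed (neg _)         f∈ = f∈
  persistent-Decomposed (ex _ _)        f∈ = f∈
  persistent-Decomposed (atLeast _ _ _) f∈ = f∈

  Decomposed-persistent : ∀ {s z C} → Persistent C → Decomposed (z , C) s → (z , C) ∈ kept s
  Decomposed-persistent (atom _)        f∈ = f∈
  Decomposed-persistent (neg _)         f∈ = f∈
  Decomposed-persistent (ex _ _)        f∈ = f∈
  Decomposed-persistent (atLeast _ _ _) f∈ = f∈

  kept-Decomposed : ∀ {s f} → Open s → f ∈ kept s → Decomposed f s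
  kept-Decomposed o f∈ = persistent-Decomposed (All.lookup (persistent o) f∈) f∈

  record QueueStep (s : Stage) : Set where
    field
      next       : Stage
      open′      : Open next
      extends    : Extends s next
      dequeued   : ∃ λ Y → queue next ≡ drop 1 (queue s) ++ Y
      new-labels : ∀ {z} → z ∈ labels next → z ∈ labels s ⊎ HasGCI z (Δ next)
      head-done  : ∀ {f rest} → queue s ≡ f ∷ rest → Decomposed f next

  ∈-enqueued : ∀ {Q Y K : Succedent} {p} → p ∈ Y → p ∈ (Q ++ Y) ++ K
  ∈-enqueued {Q} p∈ = ∈-++⁺ˡ (∈-++⁺ʳ Q p∈)

  module _ {Γ f rest K Lb} (o : Open (stage Γ (f ∷ rest) K Lb)) where

    keepHead : Persistent (proj₂ f) → QueueStep (stage Γ (f ∷ rest) K Lb)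
    keepHead p = record
      { next       = stage Γ rest (K ++ [ f ]) Lb
      ; open′      = record
        { unprovable = λ pr → unprovable o (perm pr (↭-keep f rest K))
        ; labelled   = All-resp-↭ (↭-sym (↭-keep f rest K)) (labelled o)
        ; persistent = All.++⁺ (persistent o) (p ∷ []) }
      ; extends    = extension (λ a∈ → a∈) ([ f ] , refl) (λ z∈ → z∈)
      ; dequeued   = [] , sym (++-identityʳ rest)
      ; new-labels = inj₁
      ; head-done  = λ { refl → persistent-Decomposed p (∈-++⁺ʳ K (here refl)) }
      }

    replaceHead : (Γ′ : Antecedent) (Y : Succedent) (Lb′ : List Label) → Γ ⊆ Γ′ → Lb ⊆ Lb′
      → ¬ Proves O Γ′ (Y ++ rest ++ K) → All (λ p → proj₁ p ∈ Lb′) Y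
      → (∀ {z} → z ∈ Lb′ → z ∈ Lb ⊎ HasGCI z Y) → Decomposed f (stage Γ′ (rest ++ Y) K Lb′)
      → QueueStep (stage Γ (f ∷ rest) K Lb)
    replaceHead Γ′ Y Lb′ Γ⊆ Lb⊆ unprovable′ labelledY new done = record
      { next       = stage Γ′ (rest ++ Y) K Lb′
      ; open′      = record
        { unprovable = λ pr → unprovable′ (perm pr (↭-enqueue rest Y K))
        ; labelled   = All-resp-↭ (↭-sym (↭-enqueue rest Y K))
                         (All.++⁺ labelledY (All.map Lb⊆ (All.tail (labelled o))))
        ; persistent = persistent o }
      ; extends    = extension Γ⊆ ([] , sym (++-identityʳ K)) Lb⊆
      ; dequeued   = Y , refl
      ; new-labels = λ z∈ → Sum.map₂ (All.map (∈-enqueued {rest})) (new z∈)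
      ; head-done  = λ { refl → done }
      }

  queueStep : (s : Stage) → Open s → QueueStep s
  queueStep s@(stage Γ [] K Lb) o = record
    { next = s ; open′ = o ; extends = Extends-refl ; dequeued = [] , refl
    ; new-labels = inj₁ ; head-done = λ () }
  queueStep (stage Γ ((z , atom A) ∷ rest) K Lb) o = keepHead o (atom A)
  queueStep (stage Γ ((z , neg A) ∷ rest) K Lb) o = keepHead o (neg A)
  queueStep (stage Γ ((z , ex r C) ∷ rest) K Lb) o = keepHead o (ex r C)
  queueStep (stage Γ ((z , atLeast n r C) ∷ rest) K Lb) o = keepHead o (atLeast n r C)
  queueStep (stage Γ ((z , C ⊔ D) ∷ rest) K Lb) o =
    replaceHead o Γ ((z , C) ∷ (z , D) ∷ []) Lb (λ a∈ → a∈) (λ l∈ → l∈) (unprovable o ∘ ⊔R)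
      (z∈ ∷ z∈ ∷ []) inj₁ (∈-enqueued {rest} (here refl) , ∈-enqueued {rest} (there (here refl)))
    where
    z∈ : z ∈ Lb
    z∈ = All.head (labelled o)
  queueStep (stage Γ ((z , C ⊓ D) ∷ rest) K Lb) o with lem {Proves O Γ ((z , C) ∷ rest ++ K)}
  ... | no ¬C  = replaceHead o Γ [ (z , C) ] Lb (λ a∈ → a∈) (λ l∈ → l∈) ¬C
                   (All.head (labelled o) ∷ []) inj₁ (inj₁ (∈-enqueued {rest} (here refl)))
  ... | yes ⊢C = replaceHead o Γ [ (z , D) ] Lb (λ a∈ → a∈) (λ l∈ → l∈) (unprovable o ∘ ⊓R ⊢C)
                   (All.head (labelled o) ∷ []) inj₁ (inj₂ (∈-enqueued {rest} (here refl)))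
  queueStep (stage Γ ((z , all r C) ∷ rest) K Lb) o =
    replaceHead o (rel r z y′ ∷ Γ) (withGCI O y′ C) (y′ ∷ Lb) there there
      (unprovable o ∘ ∀R (freshLabel-Fresh Γ ((z , all r C) ∷ rest ++ K) ≤-refl))
      (All.tabulate λ p∈ → here (withGCI-label O y′ C p∈)) new (y′ , here refl , ∈-enqueued {rest} (here refl))
    where
    y′ : Label
    y′ = freshLabel Γ ((z , all r C) ∷ rest ++ K)
    new : ∀ {v} → v ∈ y′ ∷ Lb → v ∈ Lb ⊎ HasGCI v (withGCI O y′ C)
    new (here refl) = inj₂ (withGCI-HasGCI y′ C)
    new (there v∈)  = inj₁ v∈
  queueStep (stage Γ ((z , atMost n r C) ∷ rest) K Lb) o =
    replaceHead o (allNeq ys ++ map (rel r z) ys ++ Γ) Y (ys ++ Lb)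
      (∈-++⁺ʳ (allNeq ys) ∘ ∈-++⁺ʳ (map (rel r z) ys)) (∈-++⁺ʳ ys)
      (unprovable o ∘ ≤R ys (length-tabulate ys′) (tabulate⁺ (block-injective m (suc n)))
                         (block-Fresh Γ ((z , atMost n r C) ∷ rest ++ K) (suc n)))
      (All.tabulate labelledY) new
      (m , (λ i → ∈-++⁺ʳ (allNeq ys) (∈-++⁺ˡ (∈-map⁺ (rel r z) (∈-tabulate⁺ {f = ys′} i))) ,
                  ∈-enqueued {rest} (∈Y i (here refl))) ,
           ∈-++⁺ˡ)
    where
    m : Label
    m = freshLabel Γ ((z , atMost n r C) ∷ rest ++ K)
    ys′ : Fin (suc n) → Label
    ys′ = block m (suc n)
    ys : List Label
    ys = tabulate ys′
    premise : Label → Succedent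
    premise y = withGCI O y (¬̇ C)
    Y : Succedent
    Y = concatMap premise ys
    ∈Y : ∀ i {p} → p ∈ premise (ys′ i) → p ∈ Y
    ∈Y i p∈ = ∈-concatMap⁺ premise (Any.tabulate⁺ {f = ys′} i p∈)
    labelledY : ∀ {p} → p ∈ Y → proj₁ p ∈ ys ++ Lb
    labelledY p∈ with i , p∈i ← Any.tabulate⁻ {f = ys′} (∈-concatMap⁻ premise p∈) =
      ∈-++⁺ˡ (subst (_∈ ys) (sym (withGCI-label O (ys′ i) (¬̇ C) p∈i)) (∈-tabulate⁺ {f = ys′} i))
    new : ∀ {v} → v ∈ ys ++ Lb → v ∈ Lb ⊎ HasGCI v Y
    new v∈ with ∈-++⁻ ys v∈
    ... | inj₂ v∈Lb = inj₁ v∈Lb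
    ... | inj₁ v∈ys with i , refl ← ∈-tabulate⁻ {f = ys′} v∈ys = inj₂ (All.map (∈Y i) (withGCI-HasGCI (ys′ i) (¬̇ C)))

  record TaskStep (s : Stage) : Set where
    field
      next        : Stage
      open′       : Open next
      extends     : Extends s next
      enqueued    : ∃ λ Y → queue next ≡ queue s ++ Y
      same-labels : labels next ≡ labels s

  idle : ∀ s → Open s → TaskStep s
  idle s o = record
    { next = s ; open′ = o ; extends = Extends-refl
    ; enqueued = [] , sym (++-identityʳ (queue s)) ; same-labels = refl }

  enqueue : ∀ s → Open s → (Y : Succedent) → ¬ Proves O (atoms s) (Y ++ Δ s)
    → All (λ p → proj₁ p ∈ labels s) Y → TaskStep s
  enqueue (stage Γ Q K Lb) o Y unprovable′ labelledY = record
    { next = stage Γ (Q ++ Y) K Lb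
    ; open′ = record
      { unprovable = λ pr → unprovable′ (perm pr (↭-enqueue Q Y K))
      ; labelled   = All-resp-↭ (↭-sym (↭-enqueue Q Y K)) (All.++⁺ labelledY (labelled o))
      ; persistent = persistent o }
    ; extends = extension (λ a∈ → a∈) ([] , sym (++-identityʳ K)) (λ z∈ → z∈)
    ; enqueued = Y , refl ; same-labels = refl }

  assume : ∀ s → Open s → (a : SAtom) → ¬ Proves O (a ∷ atoms s) (Δ s) → TaskStep s
  assume (stage Γ Q K Lb) o a unprovable′ = record
    { next = stage (a ∷ Γ) Q K Lb
    ; open′ = record { unprovable = unprovable′ ; labelled = labelled o ; persistent = persistent o }
    ; extends = extension there ([] , sym (++-identityʳ K)) (λ z∈ → z∈)
    ; enqueued = [] , sym (++-identityʳ Q) ; same-labels = refl }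

  -- What firing a persistent formula at the labels ys achieves.
  Propagated : LConcept → List Label → Stage → Stage → Set
  Propagated (_ , atom _) [] _ _ = ⊤
  Propagated (z , atom A) (y ∷ _) s s′ = y ∈ labels s → atoms s ⊢ z =* y → (y , atom A) ∈ Δ s′
  Propagated (_ , neg _) [] _ _ = ⊤
  Propagated (z , neg A) (y ∷ _) s s′ = y ∈ labels s → atoms s ⊢ z =* y → (y , neg A) ∈ Δ s′
  Propagated (_ , ex _ _) [] _ _ = ⊤
  Propagated (z , ex r C) (y ∷ _) s s′ = y ∈ labels s → Reach O (atoms s) r z y → (y , C) ∈ Δ s′
  Propagated (z , atLeast n r C) ys s s′ =
    length ys ≡ n → All (_∈ labels s) ys → All (Reach O (atoms s) r z) ys →
    Any (λ y → (y , C) ∈ Δ s′) ys ⊎ ∃ λ a → a ∈ allEqPairs ys × a ∈ atoms s′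
  Propagated (_ , _ ⊔ _) _ _ _ = ⊤
  Propagated (_ , _ ⊓ _) _ _ _ = ⊤
  Propagated (_ , all _ _) _ _ _ = ⊤
  Propagated (_ , atMost _ _ _) _ _ _ = ⊤

  ↭-second : ∀ {Δ rest : Succedent} {f p} → Δ ↭ f ∷ rest → p ∷ Δ ↭ f ∷ p ∷ rest
  ↭-second {f = f} {p} Δ↭ = ↭-trans (↭-prep p Δ↭) (↭-swap p f ↭-refl)

  -- Adds p if it is labelled and Cond holds, for a rule that derives f from f, p.
  propagateTo : ∀ s → Open s → ∀ {f} (p : LConcept) {Cond : Set} → f ∈ Δ s
    → (∀ {rest} → Cond → Proves O (atoms s) (f ∷ p ∷ rest) → Proves O (atoms s) (f ∷ rest))
    → Σ (TaskStep s) λ t → proj₁ p ∈ labels s → Cond → p ∈ Δ (TaskStep.next t)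
  propagateTo s o p {Cond} f∈ rule with lem {proj₁ p ∈ labels s × Cond}
  ... | no ¬ready = idle s o , λ l c → ⊥-elim (¬ready (l , c))
  ... | yes (l , c) with rest , Δ↭ ← ∈⇒↭∷ f∈ =
    enqueue s o [ p ] (λ pr → unprovable o (perm (rule c (perm pr (↭-second Δ↭))) (↭-sym Δ↭))) (l ∷ []) ,
    λ _ _ → ∈-enqueued {queue s} (here refl)

  propagateAtLeast : ∀ s → Open s → ∀ {z n r C} → (z , atLeast n r C) ∈ Δ s → ∀ ys
    → Σ (TaskStep s) λ t → Propagated (z , atLeast n r C) ys s (TaskStep.next t)
  propagateAtLeast s o {z} {n} {r} {C} f∈ ys
    with lem {length ys ≡ n × All (_∈ labels s) ys × All (Reach O (atoms s) r z) ys}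
  ... | no ¬ready = idle s o , λ len l rch → ⊥-elim (¬ready (len , l , rch))
  ... | yes (len , l , rch) with rest , Δ↭ ← ∈⇒↭∷ f∈
    with lem {∃ λ y → y ∈ ys × ¬ Proves O (atoms s) ((y , C) ∷ (z , atLeast n r C) ∷ rest)}
  ... | yes (y , y∈ , ¬⊢) =
    enqueue s o [ (y , C) ] (λ pr → ¬⊢ (perm pr (↭-prep _ Δ↭))) (All.lookup l y∈ ∷ []) ,
    λ _ _ _ → inj₁ (Any.map (λ { refl → ∈-enqueued {queue s} (here refl) }) y∈)
  ... | no allProvable
    with lem {∃ λ a → a ∈ allEqPairs ys × ¬ Proves O (a ∷ atoms s) ((z , atLeast n r C) ∷ rest)}
  ... | yes (a , a∈ , ¬⊢) = assume s o a (λ pr → ¬⊢ (perm pr Δ↭)) , λ _ _ _ → inj₂ (a , a∈ , here refl)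
  ... | no allProvable′ = ⊥-elim (unprovable o (perm (≥R ys len rch
          (λ y∈ → dne λ ¬⊢ → allProvable (_ , y∈ , ¬⊢)) (λ a∈ → dne λ ¬⊢ → allProvable′ (_ , a∈ , ¬⊢)))
          (↭-sym Δ↭)))
    where
    dne : ∀ {P : Set} → ¬ ¬ P → P
    dne = em⇒dne lem

  propagate : ∀ s → Open s → ∀ f ys → f ∈ Δ s → Σ (TaskStep s) λ t → Propagated f ys s (TaskStep.next t)
  propagate s o (z , atom A) (y ∷ _) f∈ = propagateTo s o (y , atom A) f∈ (s≐ (lit+ A))
  propagate s o (z , neg A) (y ∷ _) f∈ = propagateTo s o (y , neg A) f∈ (s≐ (lit- A))
  propagate s o (z , ex r C) (y ∷ _) f∈ = propagateTo s o (y , C) f∈ ∃R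
  propagate s o (z , atLeast n r C) ys f∈ = propagateAtLeast s o f∈ ys
  propagate s o (_ , atom _) [] _ = idle s o , tt
  propagate s o (_ , neg _) [] _ = idle s o , tt
  propagate s o (_ , ex _ _) [] _ = idle s o , tt
  propagate s o (_ , _ ⊔ _) _ _ = idle s o , tt
  propagate s o (_ , _ ⊓ _) _ _ = idle s o , tt
  propagate s o (_ , all _ _) _ _ = idle s o , tt
  propagate s o (_ , atMost _ _ _) _ _ = idle s o , tt

  taskStep : (t : Task) (s : Stage) → Open s → Σ (TaskStep s) λ step →
    ∀ {f} → nth (kept s) (proj₁ t) ≡ just f → Propagated f (proj₂ t) s (TaskStep.next step)
  taskStep (i , ys) s o with nth (kept s) i in found
  ... | nothing = idle s o , λ ()
  ... | just f with step , effect ← propagate s o f ys (∈-++⁺ʳ (queue s) (nth-∈ found)) = step , λ { refl → effect }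

  Literal-Persistent : ∀ {L} → Literal L → Persistent L
  Literal-Persistent (lit+ A) = atom A
  Literal-Persistent (lit- A) = neg A

  Propagated-literal : ∀ {z y ys L s s′} → Literal L → Propagated (z , L) (y ∷ ys) s s′
    → y ∈ labels s → atoms s ⊢ z =* y → (y , L) ∈ Δ s′
  Propagated-literal (lit+ _) effect = effect
  Propagated-literal (lit- _) effect = effect

  Open-no-id : ∀ {s z A} → Open s → (z , atom A) ∈ Δ s → (z , neg A) ∈ Δ s → ⊥
  Open-no-id o a∈ n∈ with ∈⇒↭∷ a∈
  ... | rest , Δ↭ with ∈-resp-↭ Δ↭ n∈
  ...   | here ()
  ...   | there n∈rest with ∈⇒↭∷ n∈rest
  ...     | _ , rest↭ = unprovable o (perm id (↭-sym (↭-trans Δ↭ (↭-prep _ rest↭))))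

  Open-no-neq : ∀ {s u v} → Open s → neq u v ∈ atoms s → atoms s ⊢ u =* v → ⊥
  Open-no-neq {s} {u} {v} o neq∈ u=v = unprovable o (setEq (id≐ (=*-mono there u=v)) absorb there)
    where
    absorb : ∀ {a} → a ∈ neq u v ∷ atoms s → a ∈ atoms s
    absorb (here refl) = neq∈
    absorb (there a∈)  = a∈

  Stable : (Stage → Set) → Set
  Stable P = ∀ {s s′} → Extends s s′ → P s → P s′

  Stable-× : ∀ {P Q} → Stable P → Stable Q → Stable (λ s → P s × Q s)
  Stable-× stP stQ ext (p , q) = stP ext p , stQ ext q

  kept-Stable : ∀ f → Stable (λ s → f ∈ kept s)
  kept-Stable _ = kept-mono

  labels-Stable : ∀ y → Stable (λ s → y ∈ labels s)
  labels-Stable _ ext = labels⊆ ext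

  =*-Stable : ∀ z y → Stable (λ s → atoms s ⊢ z =* y)
  =*-Stable _ _ ext = =*-mono (atoms⊆ ext)

  reach-Stable : ∀ r z y → Stable (λ s → Reach O (atoms s) r z y)
  reach-Stable _ _ _ ext = reachW-mono (atoms⊆ ext)

  Target : Role → Label → Label → Stage → Set
  Target r z y s = y ∈ labels s × Reach O (atoms s) r z y

  Target-Stable : ∀ r z y → Stable (Target r z y)
  Target-Stable r z y = Stable-× (labels-Stable y) (reach-Stable r z y)

  module Run (s₀ : Stage) (open₀ : Open s₀) (gci₀ : ∀ {z} → z ∈ labels s₀ → HasGCI z (Δ s₀)) where

    run : ℕ → Σ Stage Open
    run zero    = s₀ , open₀
    run (suc k) = TaskStep.next t , TaskStep.open′ t
      where
      q : QueueStep (proj₁ (run k))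
      q = queueStep (proj₁ (run k)) (proj₂ (run k))
      t : TaskStep (QueueStep.next q)
      t = proj₁ (taskStep (schedule k) (QueueStep.next q) (QueueStep.open′ q))

    S : ℕ → Stage
    S k = proj₁ (run k)

    open-S : ∀ k → Open (S k)
    open-S k = proj₂ (run k)

    queued : ∀ k → QueueStep (S k)
    queued k = queueStep (S k) (open-S k)

    M : ℕ → Stage
    M k = QueueStep.next (queued k)

    tasked : ∀ k → Σ (TaskStep (M k)) λ t → ∀ {f} → nth (kept (M k)) (proj₁ (schedule k)) ≡ just f
      → Propagated f (proj₂ (schedule k)) (M k) (TaskStep.next t)
    tasked k = taskStep (schedule k) (M k) (QueueStep.open′ (queued k))

    S⊑M : ∀ k → Extends (S k) (M k)
    S⊑M k = QueueStep.extends (queued k)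

    M⊑S : ∀ k → Extends (M k) (S (suc k))
    M⊑S k = TaskStep.extends (proj₁ (tasked k))

    S⊑S : ∀ {k k′} → k ≤ k′ → Extends (S k) (S k′)
    S⊑S k≤k′ = go (≤⇒≤′ k≤k′)
      where
      go : ∀ {k k′} → k ≤′ k′ → Extends (S k) (S k′)
      go ≤′-refl = Extends-refl
      go (≤′-step {k′} h) = Extends-trans (go h) (Extends-trans (S⊑M k′) (M⊑S k′))

    S⊑M′ : ∀ {k k′} → k ≤ k′ → Extends (S k) (M k′)
    S⊑M′ {k′ = k′} k≤k′ = Extends-trans (S⊑S k≤k′) (S⊑M k′)

    Δ-M⊆S : ∀ k → Δ (M k) ⊆ Δ (S (suc k))
    Δ-M⊆S k f∈ with TaskStep.enqueued (proj₁ (tasked k)) | M⊑S k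
    ... | Y , queue≡ | extension _ (X , kept≡) _ with ∈-++⁻ (queue (M k)) f∈
    ...   | inj₁ f∈q = subst (λ Q → _ ∈ Q ++ kept (S (suc k))) (sym queue≡) (∈-++⁺ˡ (∈-++⁺ˡ f∈q))
    ...   | inj₂ f∈k = ∈-++⁺ʳ (queue (S (suc k))) (subst (_ ∈_) (sym kept≡) (∈-++⁺ˡ f∈k))

    -- The queue is first in, first out, so every queued formula eventually reaches its head.
    reaches-head : ∀ k front back {f} → queue (S k) ≡ front ++ back → f ∈ front
      → ∃₂ λ k′ rest → queue (S k′) ≡ f ∷ rest
    reaches-head k (f ∷ front) back queue≡ (here refl) = k , front ++ back , queue≡
    reaches-head k (_ ∷ front) back queue≡ (there f∈)
      with Y , dequeued ← QueueStep.dequeued (queued k) | Y′ , enqueued ← TaskStep.enqueued (proj₁ (tasked k)) =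
      reaches-head (suc k) front (back ++ Y ++ Y′) (begin
        queue (S (suc k))                      ≡⟨ enqueued ⟩
        queue (M k) ++ Y′                      ≡⟨ cong (_++ Y′) dequeued ⟩
        (drop 1 (queue (S k)) ++ Y) ++ Y′      ≡⟨ cong (λ Q → (drop 1 Q ++ Y) ++ Y′) queue≡ ⟩
        ((front ++ back) ++ Y) ++ Y′           ≡⟨ ++-assoc (front ++ back) Y Y′ ⟩
        (front ++ back) ++ Y ++ Y′             ≡⟨ ++-assoc front back (Y ++ Y′) ⟩
        front ++ back ++ Y ++ Y′               ∎) f∈
      where open ≡-Reasoning

    Occurs : Label → Concept → Set
    Occurs z C = ∃ λ k → (z , C) ∈ Δ (S k)

    Appears : Label → Set
    Appears z = ∃ λ k → z ∈ labels (S k)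

    decomposed : ∀ {z C} → Occurs z C → ∃ λ k → Decomposed (z , C) (S k)
    decomposed (k , f∈) with ∈-++⁻ (queue (S k)) f∈
    ... | inj₂ f∈kept = k , kept-Decomposed (open-S k) f∈kept
    ... | inj₁ f∈queue with k′ , _ , head ← reaches-head k (queue (S k)) [] (sym (++-identityʳ _)) f∈queue =
      suc k′ , Decomposed-mono _ (M⊑S k′) (Δ-M⊆S k′) (QueueStep.head-done (queued k′) head)

    kept-eventually : ∀ {z C} → Persistent C → Occurs z C → ∃ λ k → (z , C) ∈ kept (S k)
    kept-eventually p occ with k , done ← decomposed occ = k , Decomposed-persistent p done

    gci-eventually : ∀ {z} k → z ∈ labels (S k) → ∃ λ j → HasGCI z (Δ (S j))
    gci-eventually zero    z∈ = zero , gci₀ z∈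
    gci-eventually (suc k) z∈
      with QueueStep.new-labels (queued k) (subst (_ ∈_) (TaskStep.same-labels (proj₁ (tasked k))) z∈)
    ... | inj₁ z∈′ = gci-eventually k z∈′
    ... | inj₂ gci = suc k , All.map (Δ-M⊆S k) gci

    eventually-× : ∀ {P Q} → Stable P → Stable Q → ∃ (P ∘ S) → ∃ (Q ∘ S) → ∃ λ k → P (S k) × Q (S k)
    eventually-× stP stQ (k , p) (k′ , q) = k ⊔ₙ k′ , stP (S⊑S (m≤m⊔n k k′)) p , stQ (S⊑S (m≤n⊔m k k′)) q

    eventually-∀ : ∀ {n} {P : Fin n → Stage → Set} → (∀ i → Stable (P i)) → (∀ i → ∃ (P i ∘ S))
      → ∃ λ k → ∀ i → P i (S k)
    eventually-∀ {zero}  _    _     = zero , λ ()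
    eventually-∀ {suc n} stPs every
      with k , p₀ , ps ← eventually-× (stPs Fin.zero) (λ ext ps i → stPs (Fin.suc i) ext (ps i))
                           (every Fin.zero) (eventually-∀ (stPs ∘ Fin.suc) (every ∘ Fin.suc)) =
      k , λ { Fin.zero → p₀ ; (Fin.suc i) → ps i }

    -- This is where the fairness of the schedule is used.
    fire : ∀ {z C P} ys → Persistent C → Occurs z C → Stable P → ∃ (P ∘ S)
      → ∃ λ k → P (M k) × Propagated (z , C) ys (M k) (S (suc k))
    fire {z} {C} {P} ys persistentC occ stP eventually-P
      with k₀ , f∈ , p ← eventually-× (kept-Stable _) stP (kept-eventually persistentC occ) eventually-P
      with i , found ← ∈⇒nth f∈
      with k , k₀≤k , scheduled ← schedule-fair (i , ys) k₀ =
      k , stP ext p , subst (λ t → Propagated (z , C) (proj₂ t) (M k) (S (suc k))) scheduled (proj₂ (tasked k) found′)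
      where
      ext : Extends (S k₀) (M k)
      ext = S⊑M′ k₀≤k
      found′ : nth (kept (M k)) (proj₁ (schedule k)) ≡ just (z , C)
      found′ with X , kept≡ ← kept-prefix ext =
        subst (λ t → nth (kept (M k)) (proj₁ t) ≡ just (z , C)) (sym scheduled)
          (subst (λ K → nth K i ≡ just (z , C)) (sym kept≡) (nth-++ (kept (S k₀)) found))

    _≈_ : Label → Label → Set
    x ≈ y = ∃ λ k → atoms (S k) ⊢ x =* y

    Reaches : Role → Label → Label → Set
    Reaches r x y = ∃ λ k → Reach O (atoms (S k)) r x y

    no-clash : ∀ {z A} → Occurs z (atom A) → Occurs z (neg A) → ⊥
    no-clash occA occN
      with k , a∈ , n∈ ← eventually-× (kept-Stable _) (kept-Stable _)
                           (kept-eventually (atom _) occA) (kept-eventually (neg _) occN) =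
      Open-no-id (open-S k) (∈-++⁺ʳ _ a∈) (∈-++⁺ʳ _ n∈)

    no-neq-clash : ∀ {u v} → (∃ λ k → neq u v ∈ atoms (S k)) → u ≈ v → ⊥
    no-neq-clash neq∈ u≈v with k , neq∈′ , u=v ← eventually-× (λ ext → atoms⊆ ext) (=*-Stable _ _) neq∈ u≈v =
      Open-no-neq (open-S k) neq∈′ u=v

    literal : ∀ {z y L} → Literal L → Occurs z L → z ≈ y → Appears y → Occurs y L
    literal {z} {y} lit occ z≈y y-appears
      with k , (y∈ , z=y) , effect ← fire [ y ] (Literal-Persistent lit) occ
             (Stable-× (labels-Stable y) (=*-Stable z y))
             (eventually-× (labels-Stable y) (=*-Stable z y) y-appears z≈y) =
      suc k , Propagated-literal lit effect y∈ z=y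

    ∃-occurs : ∀ {z y r C} → Occurs z (ex r C) → Appears y → Reaches r z y → Occurs y C
    ∃-occurs {z} {y} {r} occ y-appears z→y
      with k , (y∈ , z→y′) , effect ← fire [ y ] (ex _ _) occ (Target-Stable r z y)
             (eventually-× (labels-Stable y) (reach-Stable r z y) y-appears z→y) =
      suc k , effect y∈ z→y′

    ≥-occurs : ∀ {z n r C} → Occurs z (atLeast n r C) → (ys : Fin n → Label)
      → (∀ i → Appears (ys i) × Reaches r z (ys i))
      → (∃ λ i → Occurs (ys i) C) ⊎ (∃₂ λ i j → i ≢ j × ys i ≈ ys j)
    ≥-occurs {z} {n} {r} {C} occ ys targets = conclude fired
      where
      ready : ∃ λ k → ∀ i → Target r z (ys i) (S k)
      ready = eventually-∀ (Target-Stable r z ∘ ys) λ i →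
        eventually-× (labels-Stable _) (reach-Stable r z _) (proj₁ (targets i)) (proj₂ (targets i))
      fired : ∃ λ k → (∀ i → Target r z (ys i) (M k)) × Propagated (z , atLeast n r C) (tabulate ys) (M k) (S (suc k))
      fired = fire (tabulate ys) (atLeast n r C) occ (λ ext ps i → Target-Stable r z (ys i) ext (ps i)) ready
      conclude : (∃ λ k → (∀ i → Target r z (ys i) (M k)) × Propagated (z , atLeast n r C) (tabulate ys) (M k) (S (suc k)))
        → (∃ λ i → Occurs (ys i) C) ⊎ (∃₂ λ i j → i ≢ j × ys i ≈ ys j)
      conclude (k , targets′ , effect)
        with effect (length-tabulate ys) (All.tabulate⁺ (proj₁ ∘ targets′)) (All.tabulate⁺ (proj₂ ∘ targets′))
      ... | inj₁ found with i , c∈ ← Any.tabulate⁻ found = inj₁ (i , suc k , c∈)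
      ... | inj₂ (a , a∈ , a∈atoms) with i , j , i≢j , refl ← ∈-allEqPairs-tabulate ys a∈ =
        inj₂ (i , j , i≢j , suc k , fwd a∈atoms ◅ ε)

    ∀-occurs : ∀ {z r C} → Occurs z (all r C) → ∃ λ y → Reaches r z y × Occurs y C
    ∀-occurs occ with k , (y , r∈ , c∈) ← decomposed occ = y , (k , reach-rel r∈) , (k , c∈)

    ≤-occurs : ∀ {z n r C} → Occurs z (atMost n r C) → ∃ λ (ys : Fin (suc n) → Label) →
      (∀ i → Reaches r z (ys i) × Occurs (ys i) (¬̇ C)) × (∀ {i j} → ys i ≈ ys j → i ≡ j)
    ≤-occurs {n = n} occ with k , (m , succ , neq⊆) ← decomposed occ =
      block m (suc n) , (λ i → (k , reach-rel (proj₁ (succ i))) , (k , proj₂ (succ i))) , distinct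
      where
      distinct : ∀ {i j} → block m (suc n) i ≈ block m (suc n) j → i ≡ j
      distinct {i} {j} i≈j with i ≟ᶠ j
      ... | yes i≡j = i≡j
      ... | no i≢j with allNeq-tabulate (block m (suc n)) i≢j
      ...   | inj₁ neq∈ = ⊥-elim (no-neq-clash (k , neq⊆ neq∈) i≈j)
      ...   | inj₂ neq∈ = ⊥-elim (no-neq-clash (k , neq⊆ neq∈) (proj₁ i≈j , =*-sym (proj₂ i≈j)))

    limit : Hintikka O
    limit = record
      { branch         = atoms ∘ S
      ; branch-mono    = atoms⊆ ∘ S⊑S
      ; Appears        = Appears
      ; Occurs         = Occurs
      ; occurs-appears = λ (k , f∈) → k , All.lookup (labelled (open-S k)) f∈
      ; occurs-gci     = λ (k , z∈) E∈ → Product.map₂ (λ gci → All.lookup gci E∈) (gci-eventually k z∈)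
      ; no-clash       = no-clash
      ; literal        = literal
      ; ⊔-occurs       = λ occ → let (k , c∈ , d∈) = decomposed occ in (k , c∈) , (k , d∈)
      ; ⊓-occurs       = λ occ → let (k , c∨d) = decomposed occ in Sum.map (k ,_) (k ,_) c∨d
      ; ∃-occurs       = ∃-occurs
      ; ∀-occurs       = ∀-occurs
      ; ≤-occurs       = ≤-occurs
      ; ≥-occurs       = ≥-occurs
      }

  saturate : ∀ {x C} → ¬ Proves O [] (GCI O x ++ (x , C) ∷ [])
    → Σ (Hintikka O) λ H → Hintikka.Occurs H x C × Hintikka.Appears H x
  saturate {x} {C} ⊬ = Run.limit initial open₀ gci₀ , (zero , here refl) , (zero , here refl)
    where
    initial : Stage
    initial = stage [] (withGCI O x C) [] [ x ]
    open₀ : Open initial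
    open₀ = record
      { unprovable = λ pr → ⊬ (perm pr (↭-trans (↭-reflexive (++-identityʳ _)) (∷↭∷ʳ (x , C) (GCI O x))))
      ; labelled   = All.++⁺ (All.tabulate λ p∈ → here (withGCI-label O x C p∈)) []
      ; persistent = [] }
    gci₀ : ∀ {z} → z ∈ [ x ] → HasGCI z (Δ initial)
    gci₀ (here refl) = All.map ∈-++⁺ˡ (withGCI-HasGCI x C)

theorem2 : ExcludedMiddle 0ℓ → (O : Ontology) → IsRIQ O
    → (C : Concept) → IsConcept (rbox O) C → (x : Label)
    → Valid O [] ((x , C) ∷ [])
    → Proves O [] (GCI O x ++ (x , C) ∷ [])
theorem2 lem O _ C _ x valid = em⇒dne lem λ ⊬ →
  let H , occurs , appears = Saturation.saturate lem O ⊬ in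
  CanonicalModel.not-valid lem H occurs appears valid
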